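{- Let $n,k$ be positive integers with $k\le n$. Then (a) $\mathfrak{r}_{\triangle_{n,k}}=\sum_{i=0}^{k-1}(-1)^{k+i-1}q_{n-i}\,q_i$; (b) $\mathfrak{r}_{\triangle_{n,n-k+1}}=\mathfrak{r}_{\triangle_{n,k}}$.
   Context: Boxes are indexed $(i,j)$, row $i$ from the top, column $j$ from the left. For a composition $\alpha=(\alpha_1,\dots,\alpha_\ell)$, the (connected) ribbon $\alpha$ is the set of boxes in which row $i$ consists of $\alpha_i$ consecutive boxes ($1\le i\le\ell$) and, for each $i<\ell$, the leftmost box of row $i$ lies directly above the rightmost box of row $i+1$; up to translation it is a shifted skew diagram. With $\mathbf{P}'=\{1'<1<2'<2<\cdots\}$ and $|a|$ the unmarked version of $a$, a marked shifted tableau of a set of boxes is a filling by letters of $\mathbf{P}'$ with weakly increasing rows and columns, at most one unmarked $k$ per column and at most one $k'$ per row for each $k$; its content is $(c_1,c_2,\dots)$ with $c_i$ the number of entries $a$ with $|a|=i$. The ribbon Schur $Q$-function $\mathfrak{r}_\alpha$ is $\sum_T x_1^{c_1}x_2^{c_2}\cdots$ over all marked shifted tableaux $T$ of the ribbon $\alpha$. For $m\ge1$, $q_m=\mathfrak{r}_{(m)}$ (one row of $m$ boxes), and $q_0=1$. For $1\le k\le n$, $\triangle_{n,k}$ is the ribbon with composition $(1^{k-1},n-k+1)$, i.e. $k-1$ rows of one box followed by a row of $n-k+1$ boxes (equivalently the shifted skew diagram of $(n,n-1,\dots,n-k+1)/(n-1,\dots,n-k+1)$). -}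

module Defs where

open import Data.Nat as ℕ using (ℕ; zero; suc; _∸_; _/_; _≡ᵇ_; _<ᵇ_; _≤ᵇ_)
open import Data.Bool using (Bool; true; false; _∧_; _∨_; not; if_then_else_)
open import Data.List using (List; []; _∷_; _++_; map; concatMap; replicate; length; upTo; zip; foldr)
open import Data.Nat.ListAction using (sum)
open import Data.Product using (_×_; _,_; proj₁; proj₂)
open import Data.Integer as ℤ using (ℤ; +_)
open import Relation.Binary.PropositionalEquality using (_≡_)

-- Formal power series in x₁, x₂, … with integer coefficients.
-- A monomial x₁^{c₁} ⋯ x_N^{c_N} is encoded by its exponent list
-- (c₁ , … , c_N) (any N; trailing zeros allowed).

Series : Set
Series = List ℕ → ℤ

_≈ₛ_ : Series → Series → Set
f ≈ₛ g = ∀ (c : List ℕ) → f c ≡ g c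

allZero : List ℕ → Bool
allZero []       = true
allZero (x ∷ xs) = (x ≡ᵇ 0) ∧ allZero xs

oneₛ : Series
oneₛ c = if allZero c then + 1 else + 0

_+ₛ_ : Series → Series → Series
(f +ₛ g) c = f c ℤ.+ g c

-ₛ_ : Series → Series
(-ₛ f) c = ℤ.- f c

zeroₛ : Series
zeroₛ _ = + 0

below : List ℕ → List (List ℕ)
below []       = []  ∷ []
below (x ∷ xs) = concatMap (λ a → map (a ∷_) (below xs)) (upTo (suc x))

_-ᴸ_ : List ℕ → List ℕ → List ℕ
[]       -ᴸ _        = []
(x ∷ xs) -ᴸ []       = x ∷ xs
(x ∷ xs) -ᴸ (y ∷ ys) = (x ∸ y) ∷ (xs -ᴸ ys)

sumℤ : List ℤ → ℤ
sumℤ = foldr ℤ._+_ (+ 0)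

_*ₛ_ : Series → Series → Series
(f *ₛ g) c = sumℤ (map (λ a → f a ℤ.* g (c -ᴸ a)) (below c))

Σₛ : ℕ → (ℕ → Series) → Series
Σₛ zero    F = zeroₛ
Σₛ (suc k) F = Σₛ k F +ₛ F k

sign : ℕ → ℤ
sign zero          = + 1
sign (suc zero)    = ℤ.- (+ 1)
sign (suc (suc m)) = sign m

_·ₛ_ : ℤ → Series → Series
(z ·ₛ f) c = z ℤ.* f c

-- Boxes are
-- (row , column) with rows counted from the top (0-based) and columns
-- from the left.  Row i occupies columns s_i , … , s_i + α_i - 1 where
-- s_ℓ = 0 and s_i = s_{i+1} + α_{i+1} - 1, so that the leftmost box of
-- row i lies directly above the rightmost box of row i+1.

Box : Set
Box = ℕ × ℕ

startCol : List ℕ → ℕ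
startCol rest = sum (map (λ a → a ∸ 1) rest)

shiftRow : Box → Box
shiftRow (i , j) = (suc i , j)

ribbonBoxes : List ℕ → List Box
ribbonBoxes []         = []
ribbonBoxes (a ∷ rest) =
  map (λ j → (0 , startCol rest ℕ.+ j)) (upTo a) ++ map shiftRow (ribbonBoxes rest)

-- Letters of P' = {1' < 1 < 2' < 2 < ⋯} are encoded by ℕ:
--   code 2(k-1) = k' (marked), code 2(k-1)+1 = k (unmarked).
-- The natural order on codes is the order of P'.  |a| - 1 = code / 2.

isMarked : ℕ → Bool
isMarked zero          = true
isMarked (suc zero)    = false
isMarked (suc (suc m)) = isMarked m

pairOK : (Box × ℕ) → (Box × ℕ) → Bool
pairOK ((i , j) , a) ((i' , j') , b) =
  (if i ≡ᵇ i' then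
     ((if j <ᵇ j' then a ≤ᵇ b else true) ∧
      (if j' <ᵇ j then b ≤ᵇ a else true) ∧
      not (isMarked a ∧ isMarked b ∧ (a ≡ᵇ b)))
   else true) ∧
  (if j ≡ᵇ j' then
     ((if i <ᵇ i' then a ≤ᵇ b else true) ∧
      (if i' <ᵇ i then b ≤ᵇ a else true) ∧
      not (not (isMarked a) ∧ not (isMarked b) ∧ (a ≡ᵇ b)))
   else true)

allB : {A : Set} → (A → Bool) → List A → Bool
allB p []       = true
allB p (x ∷ xs) = p x ∧ allB p xs

isMarkedShifted : List (Box × ℕ) → Bool
isMarkedShifted []       = true
isMarkedShifted (x ∷ xs) = allB (pairOK x) xs ∧ isMarkedShifted xs

countLetter : ℕ → List ℕ → ℕ
countLetter k []       = 0
countLetter k (a ∷ as) = (if (a / 2) ≡ᵇ k then 1 else 0) ℕ.+ countLetter k as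

hasContent : List ℕ → List ℕ → Bool
hasContent c f =
  allB (λ a → a <ᵇ (2 ℕ.* length c)) f ∧
  allB (λ kc → countLetter (proj₁ kc) f ≡ᵇ proj₂ kc) (zip (upTo (length c)) c)

words : ℕ → ℕ → List (List ℕ)
words zero    L = [] ∷ []
words (suc m) L = concatMap (λ a → map (a ∷_) (words m L)) (upTo L)

countB : {A : Set} → (A → Bool) → List A → ℕ
countB p []       = 0
countB p (x ∷ xs) = (if p x then 1 else 0) ℕ.+ countB p xs

countTableaux : List Box → List ℕ → ℕ
countTableaux bs c =
  countB (λ f → isMarkedShifted (zip bs f) ∧ hasContent c f)
         (words (length bs) (2 ℕ.* length c))

𝔯 : List ℕ → Series
𝔯 α c = + countTableaux (ribbonBoxes α) c

q : ℕ → Series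
q zero    = oneₛ
q (suc m) = 𝔯 (suc m ∷ [])

△ : ℕ → ℕ → List ℕ
△ n k = replicate (k ∸ 1) 1 ++ ((n ∸ k) ℕ.+ 1 ∷ [])

-- Everything is compared coefficientwise: the coefficient of x^c in 𝔯_α counts marked shifted
-- tableaux of α with content c, i.e. words over the alphabet of codes with that content.
-- Writing h_j for the coefficient of 𝔯_{△_{n,j+1}} (a column of j boxes standing on the last
-- box of a row of n-j boxes), the proof rests on three facts:
--  * h_0 = q_n, and the Cauchy product q_a q_b counts pairs of words (u, v) with u a row
--    tableau of length a, v a row tableau of length b, and u ++ v of content c;
--  * row and column tableaux of equal length and content are equinumerous (induction on the
--    content, according to whether a word starts with 1' or 1), so v may be a column;
--  * the hook recurrence h_{j+1} + h_j = q_{n-j-1} q_{j+1}: at the corner of a pair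
--    (row r x, column t z) exactly one of "x below z", "z right of x" is allowed.
-- Part (a) follows from the recurrence by induction on j (alternating sums); part (b),
-- h_j = h_{n-1-j}, from the same recurrence together with q_a q_b = q_b q_a and
-- h_0 = q_n = h_{n-1} (a row and a column of length n).
module Submission where

open import Defs
open import Data.Nat using (ℕ; _≤_; _∸_; _+_)
open import Data.Nat using (zero; suc; _*_; _/_; _≡ᵇ_; _<ᵇ_; _≤ᵇ_; _<_; z≤n; s≤s)
open import Data.Nat.Properties
open import Data.Bool using (Bool; true; false; _∧_; not; if_then_else_; T)
open import Data.List using (List; []; _∷_; _++_; map; concatMap; length; upTo; applyUpTo; zip; replicate)
open import Data.Product using (_×_; _,_; proj₁; proj₂)
open import Data.Bool.Properties using (∧-assoc; ∧-comm; ∧-zeroʳ; ∧-identityʳ; ∧-conicalˡ; ∧-conicalʳ)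
open import Relation.Binary.PropositionalEquality
open import Function using (_∘_)
import Data.Integer as ℤ
import Data.Integer.Properties as ℤ
open import Data.Integer.Tactic.RingSolver using () renaming (solve-∀ to ℤ-solve-∀)
open import Data.Nat.DivMod using (m/n≡1+[m∸n]/n)
open import Data.List.Properties using (map-cong; applyUpTo-∷ʳ; map-applyUpTo; map-++; ++-identityʳ; ++-assoc; length-++)
open import Relation.Binary.Definitions using (Tri; tri<; tri≈; tri>)
open import Relation.Nullary using (Dec; yes; no)
open import Algebra.Properties.CommutativeSemigroup +-commutativeSemigroup
  using () renaming (interchange to +-interchange)
open import Algebra.Properties.CommutativeSemigroup *-commutativeSemigroup
  using () renaming (interchange to *-interchange)

∑ : {A : Set} → List A → (A → ℕ) → ℕ
∑ []       f = 0
∑ (x ∷ xs) f = f x + ∑ xs f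

infix 5 ∑
syntax ∑ xs (λ x → e) = ∑[ x ∈ xs ] e

𝟙 : Bool → ℕ
𝟙 true  = 1
𝟙 false = 0

𝟙-∧ : ∀ a b → 𝟙 (a ∧ b) ≡ 𝟙 a * 𝟙 b
𝟙-∧ true  b = sym (+-identityʳ _)
𝟙-∧ false b = refl

private variable A B C D : Set

∑-cong : (xs : List A) {f g : A → ℕ} → (∀ x → f x ≡ g x) → ∑ xs f ≡ ∑ xs g
∑-cong []       f≡g = refl
∑-cong (x ∷ xs) f≡g = cong₂ _+_ (f≡g x) (∑-cong xs f≡g)

∑-++ : (xs ys : List A) (f : A → ℕ) → ∑ (xs ++ ys) f ≡ ∑ xs f + ∑ ys f
∑-++ []       ys f = refl
∑-++ (x ∷ xs) ys f = trans (cong (f x +_) (∑-++ xs ys f)) (sym (+-assoc (f x) _ _))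

∑-zero : (xs : List A) → ∑[ x ∈ xs ] 0 ≡ 0
∑-zero []       = refl
∑-zero (x ∷ xs) = ∑-zero xs

∑-+ : (xs : List A) (f g : A → ℕ) → ∑[ x ∈ xs ] (f x + g x) ≡ ∑ xs f + ∑ xs g
∑-+ []       f g = refl
∑-+ (x ∷ xs) f g =
  trans (cong (f x + g x +_) (∑-+ xs f g)) (+-interchange (f x) (g x) (∑ xs f) (∑ xs g))

∑-*ˡ : (xs : List A) (k : ℕ) (f : A → ℕ) → ∑[ x ∈ xs ] (k * f x) ≡ k * ∑ xs f
∑-*ˡ []       k f = sym (*-zeroʳ k)
∑-*ˡ (x ∷ xs) k f = trans (cong (k * f x +_) (∑-*ˡ xs k f)) (sym (*-distribˡ-+ k (f x) (∑ xs f)))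

∑-*ʳ : (xs : List A) (k : ℕ) (f : A → ℕ) → ∑[ x ∈ xs ] (f x * k) ≡ ∑ xs f * k
∑-*ʳ xs k f = trans (∑-cong xs (λ x → *-comm (f x) k)) (trans (∑-*ˡ xs k f) (*-comm k _))

∑-map : (g : B → A) (ys : List B) (f : A → ℕ) → ∑ (map g ys) f ≡ ∑ ys (f ∘ g)
∑-map g []       f = refl
∑-map g (y ∷ ys) f = cong (f (g y) +_) (∑-map g ys f)

∑-concatMap : (g : B → List A) (ys : List B) (f : A → ℕ) →
  ∑ (concatMap g ys) f ≡ ∑[ y ∈ ys ] ∑ (g y) f
∑-concatMap g []       f = refl
∑-concatMap g (y ∷ ys) f =
  trans (∑-++ (g y) (concatMap g ys) f) (cong (∑ (g y) f +_) (∑-concatMap g ys f))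

∑-swap : (xs : List A) (ys : List B) (f : A → B → ℕ) →
  ∑[ x ∈ xs ] ∑[ y ∈ ys ] f x y ≡ ∑[ y ∈ ys ] ∑[ x ∈ xs ] f x y
∑-swap []       ys f = sym (∑-zero ys)
∑-swap (x ∷ xs) ys f =
  trans (cong (∑ ys (f x) +_) (∑-swap xs ys f)) (sym (∑-+ ys (f x) (λ y → ∑[ x' ∈ xs ] f x' y)))

∑-merge : (xs : List A) {f g h : A → ℕ} → (∀ x → f x + g x ≡ h x) → ∑ xs f + ∑ xs g ≡ ∑ xs h
∑-merge xs {f} {g} f+g≡h = trans (sym (∑-+ xs f g)) (∑-cong xs f+g≡h)

∑-swap₂ : (as : List A) (bs : List B) (cs : List C) (ds : List D) (f : A → B → C → D → ℕ) →
  ∑[ a ∈ as ] ∑[ b ∈ bs ] ∑[ c ∈ cs ] ∑[ d ∈ ds ] f a b c d ≡ ∑[ c ∈ cs ] ∑[ d ∈ ds ] ∑[ a ∈ as ] ∑[ b ∈ bs ] f a b c d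
∑-swap₂ as bs cs ds f = begin
  ∑[ a ∈ as ] ∑[ b ∈ bs ] ∑[ c ∈ cs ] ∑[ d ∈ ds ] f a b c d   ≡⟨ ∑-cong as (λ a → ∑-swap bs cs _) ⟩
  ∑[ a ∈ as ] ∑[ c ∈ cs ] ∑[ b ∈ bs ] ∑[ d ∈ ds ] f a b c d   ≡⟨ ∑-swap as cs _ ⟩
  ∑[ c ∈ cs ] ∑[ a ∈ as ] ∑[ b ∈ bs ] ∑[ d ∈ ds ] f a b c d   ≡⟨ ∑-cong cs (λ c → ∑-cong as (λ a → ∑-swap bs ds _)) ⟩
  ∑[ c ∈ cs ] ∑[ a ∈ as ] ∑[ d ∈ ds ] ∑[ b ∈ bs ] f a b c d   ≡⟨ ∑-cong cs (λ c → ∑-swap as ds _) ⟩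
  ∑[ c ∈ cs ] ∑[ d ∈ ds ] ∑[ a ∈ as ] ∑[ b ∈ bs ] f a b c d   ∎
  where open ≡-Reasoning

countB-∑ : (p : A → Bool) (xs : List A) → countB p xs ≡ ∑[ x ∈ xs ] 𝟙 (p x)
countB-∑ p []       = refl
countB-∑ p (x ∷ xs) with p x
... | true  = cong suc (countB-∑ p xs)
... | false = countB-∑ p xs

∑-words-∷ : (N L : ℕ) (f : List ℕ → ℕ) →
  ∑ (words (suc N) L) f ≡ ∑[ a ∈ upTo L ] ∑[ w ∈ words N L ] f (a ∷ w)
∑-words-∷ N L f =
  trans (∑-concatMap _ (upTo L) f) (∑-cong (upTo L) (λ a → ∑-map (a ∷_) (words N L) f))

∑-words-++ : (N₁ N₂ L : ℕ) (f : List ℕ → ℕ) →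
  ∑ (words (N₁ + N₂) L) f ≡ ∑[ u ∈ words N₁ L ] ∑[ v ∈ words N₂ L ] f (u ++ v)
∑-words-++ zero     N₂ L f = sym (+-identityʳ _)
∑-words-++ (suc N₁) N₂ L f = begin
  ∑ (words (suc N₁ + N₂) L) f
    ≡⟨ ∑-words-∷ (N₁ + N₂) L f ⟩
  ∑[ a ∈ upTo L ] ∑[ w ∈ words (N₁ + N₂) L ] f (a ∷ w)
    ≡⟨ ∑-cong (upTo L) (λ a → ∑-words-++ N₁ N₂ L (λ w → f (a ∷ w))) ⟩
  ∑[ a ∈ upTo L ] ∑[ u ∈ words N₁ L ] ∑[ v ∈ words N₂ L ] f (a ∷ u ++ v)
    ≡⟨ ∑-words-∷ N₁ L (λ u → ∑[ v ∈ words N₂ L ] f (u ++ v)) ⟨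
  ∑[ u ∈ words (suc N₁) L ] ∑[ v ∈ words N₂ L ] f (u ++ v) ∎
  where open ≡-Reasoning

∑-words-∷ʳ : (N L : ℕ) (f : List ℕ → ℕ) →
  ∑ (words (suc N) L) f ≡ ∑[ w ∈ words N L ] ∑[ x ∈ upTo L ] f (w ++ x ∷ [])
∑-words-∷ʳ N L f = begin
  ∑ (words (suc N) L) f                                   ≡⟨ cong (λ M → ∑ (words M L) f) (+-comm 1 N) ⟩
  ∑ (words (N + 1) L) f                                   ≡⟨ ∑-words-++ N 1 L f ⟩
  ∑[ w ∈ words N L ] ∑[ v ∈ words 1 L ] f (w ++ v)        ≡⟨ ∑-cong (words N L) (λ w → last-letter (λ v → f (w ++ v))) ⟩
  ∑[ w ∈ words N L ] ∑[ x ∈ upTo L ] f (w ++ x ∷ []) ∎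
  where
  open ≡-Reasoning
  last-letter : (g : List ℕ → ℕ) → ∑ (words 1 L) g ≡ ∑[ x ∈ upTo L ] g (x ∷ [])
  last-letter g = trans (∑-words-∷ 0 L g) (∑-cong (upTo L) (λ x → +-identityʳ _))

∑-words-cong : (N L : ℕ) {f g : List ℕ → ℕ} → (∀ w → length w ≡ N → f w ≡ g w) →
  ∑ (words N L) f ≡ ∑ (words N L) g
∑-words-cong zero    L f≡g = cong (_+ 0) (f≡g [] refl)
∑-words-cong (suc N) L {f} {g} f≡g = begin
  ∑ (words (suc N) L) f                          ≡⟨ ∑-words-∷ N L f ⟩
  ∑[ a ∈ upTo L ] ∑[ w ∈ words N L ] f (a ∷ w)   ≡⟨ ∑-cong (upTo L) (λ a → ∑-words-cong N L (λ w eq → f≡g (a ∷ w) (cong suc eq))) ⟩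
  ∑[ a ∈ upTo L ] ∑[ w ∈ words N L ] g (a ∷ w)   ≡⟨ ∑-words-∷ N L g ⟨
  ∑ (words (suc N) L) g ∎
  where open ≡-Reasoning

true⇒T : ∀ {b} → b ≡ true → T b
true⇒T refl = _

<ᵇ-true : ∀ {m n} → m < n → (m <ᵇ n) ≡ true
<ᵇ-true {zero}  {suc n} _       = refl
<ᵇ-true {suc m} {suc n} (s≤s h) = <ᵇ-true h

<ᵇ-false : ∀ {m n} → n ≤ m → (m <ᵇ n) ≡ false
<ᵇ-false {m}     {zero}  _       = refl
<ᵇ-false {suc m} {suc n} (s≤s h) = <ᵇ-false h

≤ᵇ-true : ∀ {m n} → m ≤ n → (m ≤ᵇ n) ≡ true
≤ᵇ-true {zero}  _         = refl
≤ᵇ-true {suc m} (s≤s h) = <ᵇ-true (s≤s h)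

≤ᵇ-false : ∀ {m n} → n < m → (m ≤ᵇ n) ≡ false
≤ᵇ-false {suc m} (s≤s h) = <ᵇ-false h

≡ᵇ-refl : ∀ m → (m ≡ᵇ m) ≡ true
≡ᵇ-refl zero    = refl
≡ᵇ-refl (suc m) = ≡ᵇ-refl m

≡ᵇ-sym : ∀ m n → (m ≡ᵇ n) ≡ (n ≡ᵇ m)
≡ᵇ-sym zero    zero    = refl
≡ᵇ-sym zero    (suc n) = refl
≡ᵇ-sym (suc m) zero    = refl
≡ᵇ-sym (suc m) (suc n) = ≡ᵇ-sym m n

≡ᵇ-false : ∀ {m n} → m < n → (m ≡ᵇ n) ≡ false
≡ᵇ-false {zero}  {suc n} _       = refl
≡ᵇ-false {suc m} {suc n} (s≤s h) = ≡ᵇ-false h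

≡ᵇ-false′ : ∀ {m n} → n < m → (m ≡ᵇ n) ≡ false
≡ᵇ-false′ {m} {n} h = trans (≡ᵇ-sym m n) (≡ᵇ-false h)

≡ᵇ-≡ : ∀ {m n} → (m ≡ᵇ n) ≡ true → m ≡ n
≡ᵇ-≡ {m} {n} h = ≡ᵇ⇒≡ m n (true⇒T h)

-- countsFrom o c w: for each i, the letter value o + i occurs in w exactly c_i times
-- (values counted from 0, i.e. value v stands for the letters (v+1)' and v+1).
countsFrom : ℕ → List ℕ → List ℕ → Bool
countsFrom o []      w = true
countsFrom o (x ∷ c) w = (countLetter o w ≡ᵇ x) ∧ countsFrom (suc o) c w

lettersBelow : ℕ → List ℕ → Bool
lettersBelow L = allB (_<ᵇ L)

hasContent-split : ∀ c w → hasContent c w ≡ lettersBelow (2 * length c) w ∧ countsFrom 0 c w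
hasContent-split c w = cong (lettersBelow (2 * length c) w ∧_) (zipped 0 c (λ k → k) (λ k → refl))
  where
  zipped : ∀ o c (f : ℕ → ℕ) → (∀ k → f k ≡ o + k) →
    allB (λ kc → countLetter (proj₁ kc) w ≡ᵇ proj₂ kc) (zip (applyUpTo f (length c)) c)
      ≡ countsFrom o c w
  zipped o []      f f≡ = refl
  zipped o (x ∷ c) f f≡ =
    cong₂ _∧_ (cong (λ v → countLetter v w ≡ᵇ x) (trans (f≡ 0) (+-identityʳ o)))
              (zipped (suc o) c (f ∘ suc) (λ k → trans (f≡ (suc k)) (+-suc o k)))

allB-++ : (p : A → Bool) (u v : List A) → allB p (u ++ v) ≡ allB p u ∧ allB p v
allB-++ p []      v = refl
allB-++ p (x ∷ u) v = trans (cong (p x ∧_) (allB-++ p u v)) (sym (∧-assoc (p x) _ _))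

allB-mono : ∀ {p p′ : A → Bool} xs → (∀ a → p a ≡ true → p′ a ≡ true) →
  allB p xs ≡ true → allB p′ xs ≡ true
allB-mono []                  p⇒p′ h = refl
allB-mono {p = p} (x ∷ xs) p⇒p′ h with p x in px
... | true rewrite p⇒p′ x px = allB-mono xs p⇒p′ h

countLetter-++ : ∀ k u v → countLetter k (u ++ v) ≡ countLetter k u + countLetter k v
countLetter-++ k []      v = refl
countLetter-++ k (a ∷ u) v =
  trans (cong (_ +_) (countLetter-++ k u v)) (sym (+-assoc (if (a / 2) ≡ᵇ k then 1 else 0) _ _))

-- Two words with the same letters, as far as the content and the alphabet bound can see.
SameLetters : List ℕ → List ℕ → Set
SameLetters w w′ = (∀ (p : ℕ → Bool) → allB p w ≡ allB p w′) × (∀ k → countLetter k w ≡ countLetter k w′)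

sameLetters-comm : ∀ u v → SameLetters (u ++ v) (v ++ u)
sameLetters-comm u v =
  (λ p → trans (allB-++ p u v) (trans (∧-comm (allB p u) _) (sym (allB-++ p v u)))) ,
  (λ k → trans (countLetter-++ k u v) (trans (+-comm (countLetter k u) _) (sym (countLetter-++ k v u))))

sameLetters-++ˡ : ∀ a w w′ → SameLetters w w′ → SameLetters (a ++ w) (a ++ w′)
sameLetters-++ˡ a w w′ (sameAll , sameCount) =
  (λ p → trans (allB-++ p a w) (trans (cong (allB p a ∧_) (sameAll p)) (sym (allB-++ p a w′)))) ,
  (λ k → trans (countLetter-++ k a w) (trans (cong (countLetter k a +_) (sameCount k)) (sym (countLetter-++ k a w′))))

hasContent-same : ∀ c w w′ → SameLetters w w′ → hasContent c w ≡ hasContent c w′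
hasContent-same c w w′ (sameAll , sameCount) = begin
  hasContent c w                                        ≡⟨ hasContent-split c w ⟩
  lettersBelow (2 * length c) w ∧ countsFrom 0 c w      ≡⟨ cong₂ _∧_ (sameAll _) (sameCounts 0 c) ⟩
  lettersBelow (2 * length c) w′ ∧ countsFrom 0 c w′    ≡⟨ hasContent-split c w′ ⟨
  hasContent c w′ ∎
  where
  open ≡-Reasoning
  sameCounts : ∀ o c → countsFrom o c w ≡ countsFrom o c w′
  sameCounts o []      = refl
  sameCounts o (x ∷ c) = cong₂ _∧_ (cong (_≡ᵇ x) (sameCount o)) (sameCounts (suc o) c)

hasContent-comm : ∀ c u v → hasContent c (u ++ v) ≡ hasContent c (v ++ u)
hasContent-comm c u v = hasContent-same c (u ++ v) (v ++ u) (sameLetters-comm u v)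

hasContent-exchange : ∀ c a u v → hasContent c (a ++ u ++ v) ≡ hasContent c (a ++ v ++ u)
hasContent-exchange c a u v =
  hasContent-same c (a ++ u ++ v) (a ++ v ++ u) (sameLetters-++ˡ a (u ++ v) (v ++ u) (sameLetters-comm u v))

hasContent-[] : ∀ c → hasContent c [] ≡ allZero c
hasContent-[] c = trans (hasContent-split c []) (emptyCounts 0 c)
  where
  emptyCounts : ∀ o c → countsFrom o c [] ≡ allZero c
  emptyCounts o []          = refl
  emptyCounts o (zero ∷ c)  = emptyCounts (suc o) c
  emptyCounts o (suc x ∷ c) = refl

-- Raising every letter by one value (k ↦ k+1, k' ↦ (k+1)') shifts the content by one place.
raise : List ℕ → List ℕ
raise = map (2 +_)

value-raise : ∀ a → (2 + a) / 2 ≡ suc (a / 2)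
value-raise a = m/n≡1+[m∸n]/n {2 + a} {2} (s≤s (s≤s z≤n))

countLetter-raise-0 : ∀ w → countLetter 0 (raise w) ≡ 0
countLetter-raise-0 []      = refl
countLetter-raise-0 (a ∷ w) rewrite value-raise a = countLetter-raise-0 w

countLetter-raise : ∀ k w → countLetter (suc k) (raise w) ≡ countLetter k w
countLetter-raise k []      = refl
countLetter-raise k (a ∷ w) rewrite value-raise a =
  cong ((if (a / 2) ≡ᵇ k then 1 else 0) +_) (countLetter-raise k w)

hasContent-raise : ∀ x c w → hasContent (x ∷ c) (raise w) ≡ (x ≡ᵇ 0) ∧ hasContent c w
hasContent-raise x c w = begin
  hasContent (x ∷ c) (raise w)
    ≡⟨ hasContent-split (x ∷ c) (raise w) ⟩
  lettersBelow (2 * suc (length c)) (raise w) ∧ ((countLetter 0 (raise w) ≡ᵇ x) ∧ countsFrom 1 c (raise w))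
    ≡⟨ cong₂ _∧_ (bound (2 * suc (length c)) (*-suc 2 (length c)) w)
                 (cong₂ (λ k m → (k ≡ᵇ x) ∧ m) (countLetter-raise-0 w) (counts 0 c)) ⟩
  lettersBelow (2 * length c) w ∧ ((0 ≡ᵇ x) ∧ countsFrom 0 c w)
    ≡⟨ ∧-exchange (lettersBelow (2 * length c) w) (0 ≡ᵇ x) _ ⟩
  (0 ≡ᵇ x) ∧ (lettersBelow (2 * length c) w ∧ countsFrom 0 c w)
    ≡⟨ cong₂ _∧_ (≡ᵇ-sym 0 x) (sym (hasContent-split c w)) ⟩
  (x ≡ᵇ 0) ∧ hasContent c w ∎
  where
  open ≡-Reasoning
  ∧-exchange : ∀ a b c → a ∧ (b ∧ c) ≡ b ∧ (a ∧ c)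
  ∧-exchange a b c = trans (sym (∧-assoc a b c)) (trans (cong (_∧ c) (∧-comm a b)) (∧-assoc b a c))
  bound : ∀ L → L ≡ 2 + 2 * length c → ∀ w → lettersBelow L (raise w) ≡ lettersBelow (2 * length c) w
  bound L refl []      = refl
  bound L refl (a ∷ w) = cong ((a <ᵇ 2 * length c) ∧_) (bound L refl w)
  counts : ∀ o c → countsFrom (suc o) c (raise w) ≡ countsFrom o c w
  counts o []      = refl
  counts o (x ∷ c) = cong₂ _∧_ (cong (_≡ᵇ x) (countLetter-raise o w)) (counts (suc o) c)

-- Words avoiding the letters 1' and 1 (codes 0 and 1), resp. avoiding 1' (code 0).
avoids1 : List ℕ → Bool
avoids1 = allB (2 ≤ᵇ_)

avoids1′ : List ℕ → Bool
avoids1′ = allB (0 <ᵇ_)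

avoids1⇒avoids1′ : ∀ w → avoids1 w ≡ true → avoids1′ w ≡ true
avoids1⇒avoids1′ w = allB-mono w (λ { (suc (suc b)) _ → refl })

avoids1⇒count0 : ∀ w → avoids1 w ≡ true → countLetter 0 w ≡ 0
avoids1⇒count0 []                h = refl
avoids1⇒count0 (suc (suc b) ∷ w) h rewrite value-raise b = avoids1⇒count0 w h

count0⇒avoids1 : ∀ w → countLetter 0 w ≡ 0 → avoids1 w ≡ true
count0⇒avoids1 []                h = refl
count0⇒avoids1 (suc (suc b) ∷ w) h rewrite value-raise b = count0⇒avoids1 w h

hasContent-count0 : ∀ ℓ c w → countLetter 0 w ≡ 0 → hasContent (suc ℓ ∷ c) w ≡ false
hasContent-count0 ℓ c w h rewrite hasContent-split (suc ℓ ∷ c) w | h = ∧-zeroʳ _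

hasContent-0⇒avoids1 : ∀ c w → hasContent (0 ∷ c) w ≡ true → avoids1 w ≡ true
hasContent-0⇒avoids1 c w h =
  count0⇒avoids1 w (≡ᵇ-≡ (∧-conicalˡ _ (countsFrom 1 c w) (∧-conicalʳ (lettersBelow (2 * suc (length c)) w) _ split)))
  where
  split : lettersBelow (2 * suc (length c)) w ∧ ((countLetter 0 w ≡ᵇ 0) ∧ countsFrom 1 c w) ≡ true
  split = trans (sym (hasContent-split (0 ∷ c) w)) h

value-1 : ∀ a → a < 2 → a / 2 ≡ 0
value-1 0 _ = refl
value-1 1 _ = refl
value-1 (suc (suc a)) (s≤s (s≤s ()))

hasContent-∷-1 : ∀ a ℓ c w → a < 2 → hasContent (suc ℓ ∷ c) (a ∷ w) ≡ hasContent (ℓ ∷ c) w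
hasContent-∷-1 a ℓ c w a<2 = begin
  hasContent (suc ℓ ∷ c) (a ∷ w)
    ≡⟨ hasContent-split (suc ℓ ∷ c) (a ∷ w) ⟩
  ((a <ᵇ 2 * suc (length c)) ∧ lettersBelow L w) ∧ ((countLetter 0 (a ∷ w) ≡ᵇ suc ℓ) ∧ countsFrom 1 c (a ∷ w))
    ≡⟨ cong₂ (λ b m → (b ∧ lettersBelow L w) ∧ m) (<ᵇ-true (≤-trans a<2 (*-monoʳ-≤ 2 (s≤s z≤n))))
                                                    (cong₂ _∧_ count-first (skip 0 c)) ⟩
  lettersBelow L w ∧ ((countLetter 0 w ≡ᵇ ℓ) ∧ countsFrom 1 c w)
    ≡⟨ hasContent-split (ℓ ∷ c) w ⟨
  hasContent (ℓ ∷ c) w ∎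
  where
  open ≡-Reasoning
  L = 2 * suc (length c)
  value0 : a / 2 ≡ 0
  value0 = value-1 a a<2
  count-first : (countLetter 0 (a ∷ w) ≡ᵇ suc ℓ) ≡ (countLetter 0 w ≡ᵇ ℓ)
  count-first rewrite value0 = refl
  skip : ∀ o c → countsFrom (suc o) c (a ∷ w) ≡ countsFrom (suc o) c w
  skip o []      = refl
  skip o (x ∷ c) rewrite value0 = cong ((countLetter (suc o) w ≡ᵇ x) ∧_) (skip (suc o) c)

∑-pick : ∀ n p (g : ℕ → ℕ) → ∑[ a ∈ upTo n ] 𝟙 (p ≡ᵇ a) * g a ≡ (if p <ᵇ n then g p else 0)
∑-pick zero    p g = refl
∑-pick (suc n) p g = begin
  ∑ (upTo (suc n)) F                          ≡⟨ cong (λ l → ∑ l F) (applyUpTo-∷ʳ (λ k → k) n) ⟨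
  ∑ (upTo n ++ n ∷ []) F                      ≡⟨ ∑-++ (upTo n) (n ∷ []) F ⟩
  ∑ (upTo n) F + (F n + 0)                    ≡⟨ cong (_+ (F n + 0)) (∑-pick n p g) ⟩
  (if p <ᵇ n then g p else 0) + (F n + 0)     ≡⟨ last (<-cmp p n) ⟩
  (if p <ᵇ suc n then g p else 0) ∎
  where
  open ≡-Reasoning
  F = λ a → 𝟙 (p ≡ᵇ a) * g a
  last : Tri (p < n) (p ≡ n) (n < p) →
    (if p <ᵇ n then g p else 0) + (F n + 0) ≡ (if p <ᵇ suc n then g p else 0)
  last (tri< p<n _ _)
    rewrite <ᵇ-true p<n | <ᵇ-true (m<n⇒m<1+n p<n) | ≡ᵇ-false p<n = +-identityʳ _
  last (tri≈ _ refl _)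
    rewrite <ᵇ-false (≤-refl {p}) | <ᵇ-true (n<1+n p) | ≡ᵇ-refl p = trans (+-identityʳ _) (+-identityʳ _)
  last (tri> _ _ n<p)
    rewrite <ᵇ-false (<⇒≤ n<p) | <ᵇ-false n<p | ≡ᵇ-false′ n<p = refl

∑-δ : ∀ p r x → ∑[ a ∈ upTo (suc x) ] 𝟙 (p ≡ᵇ a) * 𝟙 (r ≡ᵇ x ∸ a) ≡ 𝟙 (p + r ≡ᵇ x)
∑-δ p r x = trans (∑-pick (suc x) p (λ a → 𝟙 (r ≡ᵇ x ∸ a))) (cases (p ≤? x))
  where
  shift : ∀ p x → p ≤ x → (r ≡ᵇ x ∸ p) ≡ (p + r ≡ᵇ x)
  shift zero    x       _       = refl
  shift (suc p) (suc x) (s≤s h) = shift p x h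
  tooBig : ∀ p x → x < p → (p + r ≡ᵇ x) ≡ false
  tooBig (suc p) zero    _       = refl
  tooBig (suc p) (suc x) (s≤s h) = tooBig p x h
  cases : Dec (p ≤ x) → (if p <ᵇ suc x then 𝟙 (r ≡ᵇ x ∸ p) else 0) ≡ 𝟙 (p + r ≡ᵇ x)
  cases (yes p≤x) rewrite <ᵇ-true (s≤s p≤x) = cong 𝟙 (shift p x p≤x)
  cases (no p≰x)  rewrite <ᵇ-false (≰⇒> p≰x) | tooBig p x (≰⇒> p≰x) = refl

∑-below-∷ : ∀ x xs (F : List ℕ → ℕ) →
  ∑ (below (x ∷ xs)) F ≡ ∑[ a ∈ upTo (suc x) ] ∑[ as ∈ below xs ] F (a ∷ as)
∑-below-∷ x xs F = trans (∑-concatMap (λ a → map (a ∷_) (below xs)) (upTo (suc x)) F)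
                         (∑-cong (upTo (suc x)) (λ a → ∑-map (a ∷_) (below xs) F))

countsFrom-convolution : ∀ o c u v →
  ∑[ a ∈ below c ] 𝟙 (countsFrom o a u) * 𝟙 (countsFrom o (c -ᴸ a) v) ≡ 𝟙 (countsFrom o c (u ++ v))
countsFrom-convolution o []       u v = refl
countsFrom-convolution o (x ∷ xs) u v = begin
  ∑[ a ∈ below (x ∷ xs) ] 𝟙 (countsFrom o a u) * 𝟙 (countsFrom o ((x ∷ xs) -ᴸ a) v)
    ≡⟨ ∑-below-∷ x xs _ ⟩
  ∑[ a ∈ upTo (suc x) ] ∑[ as ∈ below xs ] 𝟙 ((nᵤ ≡ᵇ a) ∧ Mᵤ as) * 𝟙 ((nᵥ ≡ᵇ x ∸ a) ∧ Mᵥ (xs -ᴸ as))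
    ≡⟨ ∑-cong (upTo (suc x)) (λ a → ∑-cong (below xs) (λ as → separate a as)) ⟩
  ∑[ a ∈ upTo (suc x) ] ∑[ as ∈ below xs ] δ a * (𝟙 (Mᵤ as) * 𝟙 (Mᵥ (xs -ᴸ as)))
    ≡⟨ ∑-cong (upTo (suc x)) (λ a → ∑-*ˡ (below xs) (δ a) _) ⟩
  ∑[ a ∈ upTo (suc x) ] δ a * (∑[ as ∈ below xs ] 𝟙 (Mᵤ as) * 𝟙 (Mᵥ (xs -ᴸ as)))
    ≡⟨ ∑-cong (upTo (suc x)) (λ a → cong (δ a *_) (countsFrom-convolution (suc o) xs u v)) ⟩
  ∑[ a ∈ upTo (suc x) ] δ a * 𝟙 (Mᵤᵥ)
    ≡⟨ ∑-*ʳ (upTo (suc x)) (𝟙 Mᵤᵥ) δ ⟩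
  (∑[ a ∈ upTo (suc x) ] δ a) * 𝟙 Mᵤᵥ
    ≡⟨ cong (_* 𝟙 Mᵤᵥ) (∑-δ nᵤ nᵥ x) ⟩
  𝟙 (nᵤ + nᵥ ≡ᵇ x) * 𝟙 Mᵤᵥ
    ≡⟨ 𝟙-∧ (nᵤ + nᵥ ≡ᵇ x) Mᵤᵥ ⟨
  𝟙 ((nᵤ + nᵥ ≡ᵇ x) ∧ Mᵤᵥ)
    ≡⟨ cong (λ n → 𝟙 ((n ≡ᵇ x) ∧ Mᵤᵥ)) (countLetter-++ o u v) ⟨
  𝟙 (countsFrom o (x ∷ xs) (u ++ v)) ∎
  where
  open ≡-Reasoning
  nᵤ = countLetter o u
  nᵥ = countLetter o v
  Mᵤ = λ as → countsFrom (suc o) as u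
  Mᵥ = λ as → countsFrom (suc o) as v
  Mᵤᵥ = countsFrom (suc o) xs (u ++ v)
  δ = λ a → 𝟙 (nᵤ ≡ᵇ a) * 𝟙 (nᵥ ≡ᵇ x ∸ a)
  separate : ∀ a as → 𝟙 ((nᵤ ≡ᵇ a) ∧ Mᵤ as) * 𝟙 ((nᵥ ≡ᵇ x ∸ a) ∧ Mᵥ (xs -ᴸ as))
                    ≡ δ a * (𝟙 (Mᵤ as) * 𝟙 (Mᵥ (xs -ᴸ as)))
  separate a as = trans (cong₂ _*_ (𝟙-∧ (nᵤ ≡ᵇ a) _) (𝟙-∧ (nᵥ ≡ᵇ x ∸ a) _))
                        (*-interchange (𝟙 (nᵤ ≡ᵇ a)) _ (𝟙 (nᵥ ≡ᵇ x ∸ a)) _)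

∑-*-∑ : (xs : List A) (ys : List B) (f : A → ℕ) (g : B → ℕ) →
  ∑ xs f * ∑ ys g ≡ ∑[ x ∈ xs ] ∑[ y ∈ ys ] f x * g y
∑-*-∑ xs ys f g = trans (sym (∑-*ʳ xs (∑ ys g) f)) (∑-cong xs (λ x → sym (∑-*ˡ ys (f x) g)))

∑-below-length : ∀ c (F : ℕ → ℕ → List ℕ → ℕ) →
  ∑[ a ∈ below c ] F (length a) (length (c -ᴸ a)) a ≡ ∑[ a ∈ below c ] F (length c) (length c) a
∑-below-length []       F = refl
∑-below-length (x ∷ xs) F = trans (∑-below-∷ x xs _) (trans
  (∑-cong (upTo (suc x)) (λ a → ∑-below-length xs (λ n₁ n₂ as → F (suc n₁) (suc n₂) (a ∷ as))))
  (sym (∑-below-∷ x xs _)))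

count : ℕ → (List ℕ → Bool) → List ℕ → ℕ
count N P c = ∑[ w ∈ words N (2 * length c) ] 𝟙 (P w ∧ hasContent c w)

countOver : ℕ → ℕ → (List ℕ → Bool) → List ℕ → ℕ
countOver L N P a = ∑[ w ∈ words N L ] 𝟙 (P w ∧ (lettersBelow L w ∧ countsFrom 0 a w))

count-countOver : ∀ N P a → count N P a ≡ countOver (2 * length a) N P a
count-countOver N P a =
  ∑-cong (words N (2 * length a)) (λ w → cong (λ h → 𝟙 (P w ∧ h)) (hasContent-split a w))

hasContent-convolution : ∀ c u v → let Bd = lettersBelow (2 * length c) in
  ∑[ a ∈ below c ] 𝟙 (Bd u ∧ countsFrom 0 a u) * 𝟙 (Bd v ∧ countsFrom 0 (c -ᴸ a) v) ≡ 𝟙 (hasContent c (u ++ v))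
hasContent-convolution c u v = begin
  ∑[ a ∈ below c ] 𝟙 (Bd u ∧ countsFrom 0 a u) * 𝟙 (Bd v ∧ countsFrom 0 (c -ᴸ a) v)
    ≡⟨ ∑-cong (below c) (λ a → trans (cong₂ _*_ (𝟙-∧ (Bd u) _) (𝟙-∧ (Bd v) _))
                                     (*-interchange (𝟙 (Bd u)) (𝟙 (countsFrom 0 a u)) (𝟙 (Bd v)) _)) ⟩
  ∑[ a ∈ below c ] 𝟙 (Bd u) * 𝟙 (Bd v) * (𝟙 (countsFrom 0 a u) * 𝟙 (countsFrom 0 (c -ᴸ a) v))
    ≡⟨ ∑-*ˡ (below c) (𝟙 (Bd u) * 𝟙 (Bd v)) _ ⟩
  𝟙 (Bd u) * 𝟙 (Bd v) * (∑[ a ∈ below c ] 𝟙 (countsFrom 0 a u) * 𝟙 (countsFrom 0 (c -ᴸ a) v))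
    ≡⟨ cong (𝟙 (Bd u) * 𝟙 (Bd v) *_) (countsFrom-convolution 0 c u v) ⟩
  𝟙 (Bd u) * 𝟙 (Bd v) * 𝟙 (countsFrom 0 c (u ++ v))
    ≡⟨ cong (_* 𝟙 (countsFrom 0 c (u ++ v))) (𝟙-∧ (Bd u) (Bd v)) ⟨
  𝟙 (Bd u ∧ Bd v) * 𝟙 (countsFrom 0 c (u ++ v))
    ≡⟨ cong (λ b → 𝟙 b * 𝟙 (countsFrom 0 c (u ++ v))) (allB-++ (_<ᵇ 2 * length c) u v) ⟨
  𝟙 (Bd (u ++ v)) * 𝟙 (countsFrom 0 c (u ++ v))
    ≡⟨ 𝟙-∧ (Bd (u ++ v)) _ ⟨
  𝟙 (Bd (u ++ v) ∧ countsFrom 0 c (u ++ v))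
    ≡⟨ cong 𝟙 (hasContent-split c (u ++ v)) ⟨
  𝟙 (hasContent c (u ++ v)) ∎
  where
  open ≡-Reasoning
  Bd = lettersBelow (2 * length c)

count-convolution : ∀ c N₁ N₂ P Q →
  ∑[ a ∈ below c ] count N₁ P a * count N₂ Q (c -ᴸ a) ≡
  ∑[ u ∈ words N₁ (2 * length c) ] ∑[ v ∈ words N₂ (2 * length c) ]
    𝟙 (P u) * 𝟙 (Q v) * 𝟙 (hasContent c (u ++ v))
count-convolution c N₁ N₂ P Q = begin
  ∑[ a ∈ below c ] count N₁ P a * count N₂ Q (c -ᴸ a)
    ≡⟨ ∑-cong (below c) (λ a → cong₂ _*_ (count-countOver N₁ P a) (count-countOver N₂ Q (c -ᴸ a))) ⟩
  ∑[ a ∈ below c ] countOver (2 * length a) N₁ P a * countOver (2 * length (c -ᴸ a)) N₂ Q (c -ᴸ a)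
    ≡⟨ ∑-below-length c (λ n₁ n₂ a → countOver (2 * n₁) N₁ P a * countOver (2 * n₂) N₂ Q (c -ᴸ a)) ⟩
  ∑[ a ∈ below c ] countOver L N₁ P a * countOver L N₂ Q (c -ᴸ a)
    ≡⟨ ∑-cong (below c) (λ a → ∑-*-∑ (words N₁ L) (words N₂ L) _ _) ⟩
  ∑[ a ∈ below c ] ∑[ u ∈ words N₁ L ] ∑[ v ∈ words N₂ L ] G a u v
    ≡⟨ ∑-swap (below c) (words N₁ L) _ ⟩
  ∑[ u ∈ words N₁ L ] ∑[ a ∈ below c ] ∑[ v ∈ words N₂ L ] G a u v
    ≡⟨ ∑-cong (words N₁ L) (λ u → ∑-swap (below c) (words N₂ L) _) ⟩
  ∑[ u ∈ words N₁ L ] ∑[ v ∈ words N₂ L ] ∑[ a ∈ below c ] G a u v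
    ≡⟨ ∑-cong (words N₁ L) (λ u → ∑-cong (words N₂ L) (λ v → pull-out u v)) ⟩
  ∑[ u ∈ words N₁ L ] ∑[ v ∈ words N₂ L ] 𝟙 (P u) * 𝟙 (Q v) * 𝟙 (hasContent c (u ++ v)) ∎
  where
  open ≡-Reasoning
  L = 2 * length c
  X = λ a u → lettersBelow L u ∧ countsFrom 0 a u
  G : List ℕ → List ℕ → List ℕ → ℕ
  G a u v = 𝟙 (P u ∧ X a u) * 𝟙 (Q v ∧ X (c -ᴸ a) v)
  pull-out : ∀ u v → ∑[ a ∈ below c ] G a u v ≡ 𝟙 (P u) * 𝟙 (Q v) * 𝟙 (hasContent c (u ++ v))
  pull-out u v = begin
    ∑[ a ∈ below c ] G a u v
      ≡⟨ ∑-cong (below c) (λ a → trans (cong₂ _*_ (𝟙-∧ (P u) (X a u)) (𝟙-∧ (Q v) (X (c -ᴸ a) v)))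
                                       (*-interchange (𝟙 (P u)) (𝟙 (X a u)) (𝟙 (Q v)) _)) ⟩
    ∑[ a ∈ below c ] 𝟙 (P u) * 𝟙 (Q v) * (𝟙 (X a u) * 𝟙 (X (c -ᴸ a) v))
      ≡⟨ ∑-*ˡ (below c) (𝟙 (P u) * 𝟙 (Q v)) _ ⟩
    𝟙 (P u) * 𝟙 (Q v) * (∑[ a ∈ below c ] 𝟙 (X a u) * 𝟙 (X (c -ᴸ a) v))
      ≡⟨ cong (𝟙 (P u) * 𝟙 (Q v) *_) (hasContent-convolution c u v) ⟩
    𝟙 (P u) * 𝟙 (Q v) * 𝟙 (hasContent c (u ++ v)) ∎

-- rowLE a b: b may stand to the right of a in a row (a ≤ b, strictly if a is marked);
-- colLE a b: b may stand below a in a column (a ≤ b, strictly if a is unmarked).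
rowLE : ℕ → ℕ → Bool
rowLE a b = if isMarked a then a <ᵇ b else a ≤ᵇ b

colLE : ℕ → ℕ → Bool
colLE a b = if isMarked a then a ≤ᵇ b else a <ᵇ b

rowLE-pairOK : ∀ a b → (a ≤ᵇ b) ∧ not (isMarked a ∧ isMarked b ∧ (a ≡ᵇ b)) ≡ rowLE a b
rowLE-pairOK a b with isMarked a in ma
... | false = ∧-identityʳ _
... | true with <-cmp a b
...   | tri< a<b _ _ rewrite ≤ᵇ-true (<⇒≤ a<b) | ≡ᵇ-false a<b | <ᵇ-true a<b | ∧-zeroʳ (isMarked b) = refl
...   | tri≈ _ refl _ rewrite ma | ≤ᵇ-true (≤-refl {a}) | ≡ᵇ-refl a | <ᵇ-false (≤-refl {a}) = refl
...   | tri> _ _ b<a rewrite ≤ᵇ-false b<a | <ᵇ-false (<⇒≤ b<a) = refl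

colLE-pairOK : ∀ a b → (a ≤ᵇ b) ∧ not (not (isMarked a) ∧ not (isMarked b) ∧ (a ≡ᵇ b)) ≡ colLE a b
colLE-pairOK a b with isMarked a in ma
... | true = ∧-identityʳ _
... | false with <-cmp a b
...   | tri< a<b _ _ rewrite ≤ᵇ-true (<⇒≤ a<b) | ≡ᵇ-false a<b | <ᵇ-true a<b | ∧-zeroʳ (not (isMarked b)) = refl
...   | tri≈ _ refl _ rewrite ma | ≤ᵇ-true (≤-refl {a}) | ≡ᵇ-refl a | <ᵇ-false (≤-refl {a}) = refl
...   | tri> _ _ b<a rewrite ≤ᵇ-false b<a | <ᵇ-false (<⇒≤ b<a) = refl

rowLE-≤ : ∀ a b → rowLE a b ≡ true → a ≤ b
rowLE-≤ a b h with isMarked a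
... | true  = <⇒≤ (<ᵇ⇒< a b (true⇒T h))
... | false = ≤ᵇ⇒≤ a b (true⇒T h)

colLE-≤ : ∀ a b → colLE a b ≡ true → a ≤ b
colLE-≤ a b h with isMarked a
... | true  = ≤ᵇ⇒≤ a b (true⇒T h)
... | false = <⇒≤ (<ᵇ⇒< a b (true⇒T h))

rowLE-trans : ∀ a y z → rowLE a y ≡ true → rowLE y z ≡ true → rowLE a z ≡ true
rowLE-trans a y z ay yz with isMarked a
... | true  = <ᵇ-true (<-≤-trans (<ᵇ⇒< a y (true⇒T ay)) (rowLE-≤ y z yz))
... | false = ≤ᵇ-true (≤-trans (≤ᵇ⇒≤ a y (true⇒T ay)) (rowLE-≤ y z yz))

colLE-trans : ∀ a y z → colLE a y ≡ true → colLE y z ≡ true → colLE a z ≡ true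
colLE-trans a y z ay yz with isMarked a
... | true  = ≤ᵇ-true (≤-trans (≤ᵇ⇒≤ a y (true⇒T ay)) (colLE-≤ y z yz))
... | false = <ᵇ-true (<-≤-trans (<ᵇ⇒< a y (true⇒T ay)) (colLE-≤ y z yz))

-- The two orders are dual: z may stand above x exactly when x may not stand left of z.
-- This decides which of two hook tableaux a pair (row, column) of fillings belongs to.
colLE-dual : ∀ z x → colLE z x ≡ not (rowLE x z)
colLE-dual z x with <-cmp z x
... | tri< z<x _ _ = trans (below-larger (isMarked z)) (cong not (sym (left-of-smaller (isMarked x))))
  where
  below-larger : ∀ m → (if m then z ≤ᵇ x else z <ᵇ x) ≡ true
  below-larger true  = ≤ᵇ-true (<⇒≤ z<x)
  below-larger false = <ᵇ-true z<x
  left-of-smaller : ∀ m → (if m then x <ᵇ z else x ≤ᵇ z) ≡ false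
  left-of-smaller true  = <ᵇ-false (<⇒≤ z<x)
  left-of-smaller false = ≤ᵇ-false z<x
... | tri≈ _ refl _ = diagonal (isMarked z)
  where
  diagonal : ∀ m → (if m then z ≤ᵇ z else z <ᵇ z) ≡ not (if m then z <ᵇ z else z ≤ᵇ z)
  diagonal true  rewrite ≤ᵇ-true (≤-refl {z}) | <ᵇ-false (≤-refl {z}) = refl
  diagonal false rewrite ≤ᵇ-true (≤-refl {z}) | <ᵇ-false (≤-refl {z}) = refl
... | tri> _ _ x<z = trans (below-smaller (isMarked z)) (cong not (sym (left-of-larger (isMarked x))))
  where
  below-smaller : ∀ m → (if m then z ≤ᵇ x else z <ᵇ x) ≡ false
  below-smaller true  = ≤ᵇ-false x<z
  below-smaller false = <ᵇ-false (<⇒≤ x<z)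
  left-of-larger : ∀ m → (if m then x <ᵇ z else x ≤ᵇ z) ≡ true
  left-of-larger true  = <ᵇ-true x<z
  left-of-larger false = ≤ᵇ-true (<⇒≤ x<z)

Chain : (ℕ → ℕ → Bool) → List ℕ → Bool
Chain R []       = true
Chain R (x ∷ xs) = allB (R x) xs ∧ Chain R xs

Chain-∷ʳ : ∀ R xs x → Chain R (xs ++ x ∷ []) ≡ Chain R xs ∧ allB (λ a → R a x) xs
Chain-∷ʳ R []       x = refl
Chain-∷ʳ R (a ∷ xs) x = trans (cong₂ _∧_ (allB-++ (R a) xs (x ∷ [])) (Chain-∷ʳ R xs x))
                              (regroup (allB (R a) xs) (R a x) (Chain R xs) _)
  where
  regroup : ∀ p q r s → (p ∧ (q ∧ true)) ∧ (r ∧ s) ≡ (p ∧ r) ∧ (q ∧ s)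
  regroup true  true  r s = refl
  regroup true  false r s = sym (∧-zeroʳ r)
  regroup false q     r s = refl

Chain-∷ʳ-trans : ∀ R → (∀ a y z → R a y ≡ true → R y z ≡ true → R a z ≡ true) →
  ∀ xs y z → Chain R ((xs ++ y ∷ []) ++ z ∷ []) ≡ Chain R (xs ++ y ∷ []) ∧ R y z
Chain-∷ʳ-trans R trans-R xs y z
  rewrite Chain-∷ʳ R (xs ++ y ∷ []) z | allB-++ (λ a → R a z) xs (y ∷ []) | Chain-∷ʳ R xs y
  with R y z in yz | Chain R xs | allB (λ a → R a y) xs in xs-y
... | false | p     | q     rewrite ∧-zeroʳ (allB (λ a → R a z) xs) | ∧-zeroʳ (p ∧ q) = refl
... | true  | false | q     = refl
... | true  | true  | false = refl
... | true  | true  | true  rewrite allB-mono xs (λ a ay → trans-R a y z ay yz) xs-y = refl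

rowBoxes : ℕ → ℕ → ℕ → List Box
rowBoxes i s zero    = []
rowBoxes i s (suc m) = (i , s) ∷ rowBoxes i (suc s) m

colBoxes : ℕ → ℕ → ℕ → List Box
colBoxes i s zero    = []
colBoxes i s (suc j) = (i , s) ∷ colBoxes (suc i) s j

length-rowBoxes : ∀ i s m → length (rowBoxes i s m) ≡ m
length-rowBoxes i s zero    = refl
length-rowBoxes i s (suc m) = cong suc (length-rowBoxes i (suc s) m)

length-colBoxes : ∀ i s j → length (colBoxes i s j) ≡ j
length-colBoxes i s zero    = refl
length-colBoxes i s (suc j) = cong suc (length-colBoxes (suc i) s j)

rowBoxes-∷ʳ : ∀ i s m → rowBoxes i s (suc m) ≡ rowBoxes i s m ++ (i , s + m) ∷ []
rowBoxes-∷ʳ i s zero    = cong (λ z → (i , z) ∷ []) (sym (+-identityʳ s))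
rowBoxes-∷ʳ i s (suc m) = cong ((i , s) ∷_)
  (trans (rowBoxes-∷ʳ i (suc s) m) (cong (λ z → rowBoxes i (suc s) m ++ (i , z) ∷ []) (sym (+-suc s m))))

ribbon-row : ∀ m → ribbonBoxes (m ∷ []) ≡ rowBoxes 0 0 m
ribbon-row m = trans (++-identityʳ _) (trans (map-applyUpTo (λ k → k) _ m) (enumerate 0 m (λ k → refl)))
  where
  enumerate : ∀ s m {h : ℕ → Box} → (∀ k → h k ≡ (0 , s + k)) → applyUpTo h m ≡ rowBoxes 0 s m
  enumerate s zero    h≡ = refl
  enumerate s (suc m) h≡ = cong₂ _∷_ (trans (h≡ 0) (cong (0 ,_) (+-identityʳ s)))
    (enumerate (suc s) m (λ k → trans (h≡ (suc k)) (cong (0 ,_) (+-suc s k))))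

ribbon-hook : ∀ j m → ribbonBoxes (replicate j 1 ++ m ∷ []) ≡ colBoxes 0 (m ∸ 1) j ++ rowBoxes j 0 m
ribbon-hook zero    m = ribbon-row m
ribbon-hook (suc j) m = cong₂ _∷_ (cong (0 ,_) (trans (+-identityʳ _) (startCol-hook j)))
  (begin
    map shiftRow (ribbonBoxes (replicate j 1 ++ m ∷ []))
      ≡⟨ cong (map shiftRow) (ribbon-hook j m) ⟩
    map shiftRow (colBoxes 0 (m ∸ 1) j ++ rowBoxes j 0 m)
      ≡⟨ map-++ shiftRow (colBoxes 0 (m ∸ 1) j) (rowBoxes j 0 m) ⟩
    map shiftRow (colBoxes 0 (m ∸ 1) j) ++ map shiftRow (rowBoxes j 0 m)
      ≡⟨ cong₂ _++_ (shift-col 0 j) (shift-row j 0 m) ⟩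
    colBoxes 1 (m ∸ 1) j ++ rowBoxes (suc j) 0 m ∎)
  where
  open ≡-Reasoning
  startCol-hook : ∀ j → startCol (replicate j 1 ++ m ∷ []) ≡ m ∸ 1
  startCol-hook zero    = +-identityʳ _
  startCol-hook (suc j) = startCol-hook j
  shift-col : ∀ i j → map shiftRow (colBoxes i (m ∸ 1) j) ≡ colBoxes (suc i) (m ∸ 1) j
  shift-col i zero    = refl
  shift-col i (suc j) = cong ((suc i , m ∸ 1) ∷_) (shift-col (suc i) j)
  shift-row : ∀ i s m → map shiftRow (rowBoxes i s m) ≡ rowBoxes (suc i) s m
  shift-row i s zero    = refl
  shift-row i s (suc m) = cong ((suc i , s) ∷_) (shift-row i (suc s) m)

zip-++ : (xs ys : List A) (us vs : List B) → length xs ≡ length us →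
  zip (xs ++ ys) (us ++ vs) ≡ zip xs us ++ zip ys vs
zip-++ []       ys []       vs _  = refl
zip-++ (x ∷ xs) ys (u ∷ us) vs eq = cong ((x , u) ∷_) (zip-++ xs ys us vs (suc-injective eq))

across : List (Box × ℕ) → List (Box × ℕ) → Bool
across xs ys = allB (λ p → allB (pairOK p) ys) xs

isMarkedShifted-++ : ∀ xs ys →
  isMarkedShifted (xs ++ ys) ≡ (isMarkedShifted xs ∧ isMarkedShifted ys) ∧ across xs ys
isMarkedShifted-++ []       ys = sym (∧-identityʳ _)
isMarkedShifted-++ (x ∷ xs) ys =
  trans (cong₂ _∧_ (allB-++ (pairOK x) xs ys) (isMarkedShifted-++ xs ys))
        (regroup (allB (pairOK x) xs) (allB (pairOK x) ys) (isMarkedShifted xs) (isMarkedShifted ys) (across xs ys))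
  where
  regroup : ∀ a₁ a₂ i₁ i₂ c → (a₁ ∧ a₂) ∧ ((i₁ ∧ i₂) ∧ c) ≡ ((a₁ ∧ i₁) ∧ i₂) ∧ (a₂ ∧ c)
  regroup true  true  i₁ i₂ c = refl
  regroup true  false i₁ i₂ c rewrite ∧-zeroʳ (i₁ ∧ i₂) = refl
  regroup false a₂    i₁ i₂ c = refl

isMarkedShifted-row : ∀ i s m w → length w ≡ m → isMarkedShifted (zip (rowBoxes i s m) w) ≡ Chain rowLE w
isMarkedShifted-row i s zero    []      _  = refl
isMarkedShifted-row i s (suc m) (b ∷ w) eq =
  cong₂ _∧_ (to-the-right s (suc s) m b w ≤-refl (suc-injective eq)) (isMarkedShifted-row i (suc s) m w (suc-injective eq))
  where
  to-the-right : ∀ s s′ m a w → s < s′ → length w ≡ m →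
    allB (pairOK ((i , s) , a)) (zip (rowBoxes i s′ m) w) ≡ allB (rowLE a) w
  to-the-right s s′ zero    a []      _   _  = refl
  to-the-right s s′ (suc m) a (b ∷ w) s<s′ eq
    rewrite ≡ᵇ-refl i | <ᵇ-true s<s′ | <ᵇ-false (<⇒≤ s<s′) | ≡ᵇ-false s<s′ =
    cong₂ _∧_ (trans (∧-identityʳ _) (rowLE-pairOK a b))
              (to-the-right s (suc s′) m a w (m<n⇒m<1+n s<s′) (suc-injective eq))

isMarkedShifted-col : ∀ i s j w → length w ≡ j → isMarkedShifted (zip (colBoxes i s j) w) ≡ Chain colLE w
isMarkedShifted-col i s zero    []      _  = refl
isMarkedShifted-col i s (suc j) (b ∷ w) eq =
  cong₂ _∧_ (further-down i (suc i) j b w ≤-refl (suc-injective eq)) (isMarkedShifted-col (suc i) s j w (suc-injective eq))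
  where
  further-down : ∀ i i′ j a w → i < i′ → length w ≡ j →
    allB (pairOK ((i , s) , a)) (zip (colBoxes i′ s j) w) ≡ allB (colLE a) w
  further-down i i′ zero    a []      _   _  = refl
  further-down i i′ (suc j) a (b ∷ w) i<i′ eq
    rewrite ≡ᵇ-refl s | <ᵇ-true i<i′ | <ᵇ-false (<⇒≤ i<i′) | ≡ᵇ-false i<i′ =
    cong₂ _∧_ (colLE-pairOK a b) (further-down i (suc i′) j a w (m<n⇒m<1+n i<i′) (suc-injective eq))

-- In the hook, a box of the column meets the row only in the corner column.
column-across-row : ∀ i j jr m′ t r x → i + j ≤ jr → length t ≡ j → length r ≡ m′ →
  across (zip (colBoxes i m′ j) t) (zip (rowBoxes jr 0 (suc m′)) (r ++ x ∷ [])) ≡ allB (λ a → colLE a x) t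
column-across-row i zero    jr m′ []      r x _  _  _  = refl
column-across-row i (suc j) jr m′ (a ∷ t) r x ij≤ et er =
  cong₂ _∧_ (box-across-row (≤-trans (s≤s (m≤m+n i j)) ij≤′))
            (column-across-row (suc i) j jr m′ t r x ij≤′ (suc-injective et) er)
  where
  ij≤′ : suc i + j ≤ jr
  ij≤′ = subst (_≤ jr) (+-suc i j) ij≤
  off-column : ∀ s m w → s + m ≤ m′ → i < jr → allB (pairOK ((i , m′) , a)) (zip (rowBoxes jr s m) w) ≡ true
  off-column s zero    w       _    _    = refl
  off-column s (suc m) []      _    _    = refl
  off-column s (suc m) (b ∷ w) sm≤ i<jr
    rewrite ≡ᵇ-false i<jr | ≡ᵇ-false′ (≤-trans (s≤s (m≤m+n s m)) (subst (_≤ m′) (+-suc s m) sm≤)) =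
    off-column (suc s) m w (subst (_≤ m′) (+-suc s m) sm≤) i<jr
  box-across-row : i < jr → allB (pairOK ((i , m′) , a)) (zip (rowBoxes jr 0 (suc m′)) (r ++ x ∷ [])) ≡ colLE a x
  box-across-row i<jr
    rewrite rowBoxes-∷ʳ jr 0 m′
          | zip-++ (rowBoxes jr 0 m′) ((jr , m′) ∷ []) r (x ∷ []) (trans (length-rowBoxes jr 0 m′) (sym er))
          | allB-++ (pairOK ((i , m′) , a)) (zip (rowBoxes jr 0 m′) r) (((jr , m′) , x) ∷ [])
          | off-column 0 m′ r ≤-refl i<jr
          | ≡ᵇ-false i<jr | ≡ᵇ-refl m′ | <ᵇ-true i<jr | <ᵇ-false (<⇒≤ i<jr) =
    trans (∧-identityʳ _) (colLE-pairOK a x)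

isMarkedShifted-hook : ∀ j m′ t r x → length t ≡ j → length r ≡ m′ →
  isMarkedShifted (zip (colBoxes 0 m′ j ++ rowBoxes j 0 (suc m′)) (t ++ r ++ x ∷ []))
    ≡ Chain colLE (t ++ x ∷ []) ∧ Chain rowLE (r ++ x ∷ [])
isMarkedShifted-hook j m′ t r x et er
  rewrite zip-++ (colBoxes 0 m′ j) (rowBoxes j 0 (suc m′)) t (r ++ x ∷ []) (trans (length-colBoxes 0 m′ j) (sym et))
        | isMarkedShifted-++ (zip (colBoxes 0 m′ j) t) (zip (rowBoxes j 0 (suc m′)) (r ++ x ∷ []))
        | isMarkedShifted-col 0 m′ j t et
        | isMarkedShifted-row j 0 (suc m′) (r ++ x ∷ []) (trans (length-++ r) (trans (+-comm (length r) 1) (cong suc er)))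
        | column-across-row 0 j j m′ t r x ≤-refl et er
        | Chain-∷ʳ colLE t x =
  regroup (Chain colLE t) (Chain rowLE (r ++ x ∷ [])) (allB (λ a → colLE a x) t)
  where
  regroup : ∀ p q r → (p ∧ q) ∧ r ≡ (p ∧ r) ∧ q
  regroup true  q r = ∧-comm q r
  regroup false q r = refl

rowCount colCount : ℕ → List ℕ → ℕ
rowCount m = count m (Chain rowLE)
colCount m = count m (Chain colLE)

hookCount : ℕ → ℕ → List ℕ → ℕ
hookCount j m′ c =
  ∑[ t ∈ words j L ] ∑[ r ∈ words m′ L ] ∑[ x ∈ upTo L ]
    𝟙 ((Chain colLE (t ++ x ∷ []) ∧ Chain rowLE (r ++ x ∷ [])) ∧ hasContent c (t ++ r ++ x ∷ []))
  where L = 2 * length c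

countTableaux-row : ∀ m c → countTableaux (ribbonBoxes (m ∷ [])) c ≡ rowCount m c
countTableaux-row m c rewrite ribbon-row m = begin
  countB F (words (length (rowBoxes 0 0 m)) L)        ≡⟨ countB-∑ F (words (length (rowBoxes 0 0 m)) L) ⟩
  ∑[ w ∈ words (length (rowBoxes 0 0 m)) L ] 𝟙 (F w) ≡⟨ cong (λ N → ∑[ w ∈ words N L ] 𝟙 (F w)) (length-rowBoxes 0 0 m) ⟩
  ∑[ w ∈ words m L ] 𝟙 (F w)                           ≡⟨ ∑-words-cong m L (λ w e → cong (λ b → 𝟙 (b ∧ hasContent c w)) (isMarkedShifted-row 0 0 m w e)) ⟩
  rowCount m c ∎
  where
  open ≡-Reasoning
  L = 2 * length c
  F = λ w → isMarkedShifted (zip (rowBoxes 0 0 m) w) ∧ hasContent c w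

countTableaux-hook : ∀ j m′ c → countTableaux (ribbonBoxes (replicate j 1 ++ suc m′ ∷ [])) c ≡ hookCount j m′ c
countTableaux-hook j m′ c rewrite ribbon-hook j (suc m′) = begin
  countB F (words (length hook) L)
    ≡⟨ countB-∑ F (words (length hook) L) ⟩
  ∑[ w ∈ words (length hook) L ] 𝟙 (F w)
    ≡⟨ cong (λ N → ∑[ w ∈ words N L ] 𝟙 (F w)) length-hook ⟩
  ∑[ w ∈ words (j + suc m′) L ] 𝟙 (F w)
    ≡⟨ ∑-words-++ j (suc m′) L (λ w → 𝟙 (F w)) ⟩
  ∑[ t ∈ words j L ] ∑[ rx ∈ words (suc m′) L ] 𝟙 (F (t ++ rx))
    ≡⟨ ∑-words-cong j L (λ t et → trans (∑-words-∷ʳ m′ L (λ rx → 𝟙 (F (t ++ rx))))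
         (∑-words-cong m′ L (λ r er → ∑-cong (upTo L) (λ x →
            cong (λ b → 𝟙 (b ∧ hasContent c (t ++ r ++ x ∷ []))) (isMarkedShifted-hook j m′ t r x et er))))) ⟩
  hookCount j m′ c ∎
  where
  open ≡-Reasoning
  L = 2 * length c
  hook = colBoxes 0 m′ j ++ rowBoxes j 0 (suc m′)
  F = λ w → isMarkedShifted (zip hook w) ∧ hasContent c w
  length-hook : length hook ≡ j + suc m′
  length-hook = trans (length-++ (colBoxes 0 m′ j)) (cong₂ _+_ (length-colBoxes 0 m′ j) (length-rowBoxes j 0 (suc m′)))

∑-first-letter : ∀ N L (f : List ℕ → ℕ) → ∑ (words (suc N) (2 + L)) f ≡
  (∑[ w ∈ words N (2 + L) ] f (0 ∷ w)) + ((∑[ w ∈ words N (2 + L) ] f (1 ∷ w)) +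
    (∑[ a ∈ upTo L ] ∑[ w ∈ words N (2 + L) ] f ((2 + a) ∷ w)))
∑-first-letter N L f = trans (∑-words-∷ N (2 + L) f)
  (cong (λ s → g 0 + (g 1 + s))
    (trans (cong (λ l → ∑ l g) (sym (map-applyUpTo (λ k → k) (2 +_) L))) (∑-map (2 +_) (upTo L) g)))
  where g = λ a → ∑[ w ∈ words N (2 + L) ] f (a ∷ w)

∑-avoids1 : ∀ N L (f : List ℕ → ℕ) →
  ∑[ w ∈ words N (2 + L) ] 𝟙 (avoids1 w) * f w ≡ ∑[ w ∈ words N L ] f (raise w)
∑-avoids1 zero    L f = cong (_+ 0) (+-identityʳ (f []))
∑-avoids1 (suc N) L f = begin
  ∑[ w ∈ words (suc N) (2 + L) ] 𝟙 (avoids1 w) * f w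
    ≡⟨ ∑-first-letter N L _ ⟩
  (∑[ w ∈ words N (2 + L) ] 0) + ((∑[ w ∈ words N (2 + L) ] 0) + (∑[ a ∈ upTo L ] ∑[ w ∈ words N (2 + L) ] h a w))
    ≡⟨ cong₂ (λ s₀ s₁ → s₀ + (s₁ + rest)) (∑-zero (words N (2 + L))) (∑-zero (words N (2 + L))) ⟩
  ∑[ a ∈ upTo L ] ∑[ w ∈ words N (2 + L) ] h a w
    ≡⟨ ∑-cong (upTo L) (λ a → ∑-avoids1 N L (λ w → f ((2 + a) ∷ w))) ⟩
  ∑[ a ∈ upTo L ] ∑[ w ∈ words N L ] f (raise (a ∷ w))
    ≡⟨ ∑-words-∷ N L (f ∘ raise) ⟨
  ∑[ w ∈ words (suc N) L ] f (raise w) ∎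
  where
  open ≡-Reasoning
  h = λ a w → 𝟙 (avoids1 ((2 + a) ∷ w)) * f ((2 + a) ∷ w)
  rest = ∑[ a ∈ upTo L ] ∑[ w ∈ words N (2 + L) ] h a w

RaiseInvariant : (ℕ → ℕ → Bool) → Set
RaiseInvariant R = ∀ a b → R (2 + a) (2 + b) ≡ R a b

Refines≤ : (ℕ → ℕ → Bool) → Set
Refines≤ R = ∀ a b → R a b ≡ true → a ≤ b

≤ᵇ-raise : ∀ a b → (2 + a ≤ᵇ 2 + b) ≡ (a ≤ᵇ b)
≤ᵇ-raise zero    b = refl
≤ᵇ-raise (suc a) b = refl

rowLE-raise : RaiseInvariant rowLE
rowLE-raise a b with isMarked a
... | true  = refl
... | false = ≤ᵇ-raise a b

colLE-raise : RaiseInvariant colLE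
colLE-raise a b with isMarked a
... | true  = ≤ᵇ-raise a b
... | false = refl

Chain-raise : ∀ R → RaiseInvariant R → ∀ w → Chain R (raise w) ≡ Chain R w
Chain-raise R inv []      = refl
Chain-raise R inv (a ∷ w) = cong₂ _∧_ (after w) (Chain-raise R inv w)
  where
  after : ∀ w → allB (R (2 + a)) (raise w) ≡ allB (R a) w
  after []      = refl
  after (b ∷ w) = cong₂ _∧_ (inv a b) (after w)

chain-from-2 : ∀ R → Refines≤ R → ∀ ℓ c a w →
  allB (R (2 + a)) w ≡ true → hasContent (suc ℓ ∷ c) ((2 + a) ∷ w) ≡ false
chain-from-2 R refines ℓ c a w chain = hasContent-count0 ℓ c ((2 + a) ∷ w) (avoids1⇒count0 ((2 + a) ∷ w)
  (allB-mono w (λ b ab → ≤ᵇ-true (≤-trans (s≤s (s≤s z≤n)) (refines (2 + a) b ab))) chain))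

guardedChains : (List ℕ → Bool) → (ℕ → ℕ → Bool) → ℕ → ℕ → List ℕ → ℕ
guardedChains g R N ℓ c =
  ∑[ w ∈ words N (2 + 2 * length c) ] 𝟙 ((g w ∧ Chain R w) ∧ hasContent (ℓ ∷ c) w)

chains : (ℕ → ℕ → Bool) → ℕ → ℕ → List ℕ → ℕ
chains = guardedChains (λ _ → true)

count-chains : ∀ R N ℓ c → count N (Chain R) (ℓ ∷ c) ≡ chains R N ℓ c
count-chains R N ℓ c =
  cong (λ L → ∑[ w ∈ words N L ] 𝟙 (Chain R w ∧ hasContent (ℓ ∷ c) w)) (*-suc 2 (length c))

-- Content (0, c): nothing of value 1, so the chains are raised chains of content c.
chains-0 : ∀ R → RaiseInvariant R → ∀ N c → chains R N 0 c ≡ count N (Chain R) c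
chains-0 R inv N c = begin
  chains R N 0 c
    ≡⟨ ∑-cong (words N _) avoid ⟩
  ∑[ w ∈ words N (2 + 2 * length c) ] 𝟙 (avoids1 w) * 𝟙 (Chain R w ∧ hasContent (0 ∷ c) w)
    ≡⟨ ∑-avoids1 N (2 * length c) (λ w → 𝟙 (Chain R w ∧ hasContent (0 ∷ c) w)) ⟩
  ∑[ w ∈ words N (2 * length c) ] 𝟙 (Chain R (raise w) ∧ hasContent (0 ∷ c) (raise w))
    ≡⟨ ∑-cong (words N _) (λ w → cong₂ (λ p h → 𝟙 (p ∧ h)) (Chain-raise R inv w) (hasContent-raise 0 c w)) ⟩
  count N (Chain R) c ∎
  where
  open ≡-Reasoning
  avoid : ∀ w → 𝟙 (Chain R w ∧ hasContent (0 ∷ c) w) ≡ 𝟙 (avoids1 w) * 𝟙 (Chain R w ∧ hasContent (0 ∷ c) w)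
  avoid w with hasContent (0 ∷ c) w in h
  ... | true  rewrite hasContent-0⇒avoids1 c w h = sym (+-identityʳ _)
  ... | false rewrite ∧-zeroʳ (Chain R w) = sym (*-zeroʳ (𝟙 (avoids1 w)))

guardedChains-[] : ∀ g R ℓ c → guardedChains g R 0 (suc ℓ) c ≡ 0
guardedChains-[] g R ℓ c rewrite hasContent-[] (suc ℓ ∷ c) | ∧-zeroʳ (g [] ∧ true) = refl

-- With content (ℓ+1, c) a chain starts with 1' or 1; removing it leaves content (ℓ, c).
guardedChains-suc : ∀ g R → Refines≤ R → ∀ N ℓ c → guardedChains g R (suc N) (suc ℓ) c ≡
  (∑[ w ∈ words N (2 + 2 * length c) ] 𝟙 ((g (0 ∷ w) ∧ (allB (R 0) w ∧ Chain R w)) ∧ hasContent (ℓ ∷ c) w)) +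
  ((∑[ w ∈ words N (2 + 2 * length c) ] 𝟙 ((g (1 ∷ w) ∧ (allB (R 1) w ∧ Chain R w)) ∧ hasContent (ℓ ∷ c) w)) + 0)
guardedChains-suc g R refines N ℓ c =
  trans (∑-first-letter N L _)
        (cong₂ _+_ (drop-first 0 (s≤s z≤n)) (cong₂ _+_ (drop-first 1 (s≤s (s≤s z≤n))) from-2-vanishes))
  where
  L = 2 * length c
  drop-first : ∀ a → a < 2 →
    ∑[ w ∈ words N (2 + L) ] 𝟙 ((g (a ∷ w) ∧ Chain R (a ∷ w)) ∧ hasContent (suc ℓ ∷ c) (a ∷ w)) ≡
    ∑[ w ∈ words N (2 + L) ] 𝟙 ((g (a ∷ w) ∧ Chain R (a ∷ w)) ∧ hasContent (ℓ ∷ c) w)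
  drop-first a a<2 = ∑-cong (words N (2 + L)) (λ w → cong (λ h → 𝟙 ((g (a ∷ w) ∧ Chain R (a ∷ w)) ∧ h))
                                                         (hasContent-∷-1 a ℓ c w a<2))
  vanishes : ∀ a w → 𝟙 ((g ((2 + a) ∷ w) ∧ Chain R ((2 + a) ∷ w)) ∧ hasContent (suc ℓ ∷ c) ((2 + a) ∷ w)) ≡ 0
  vanishes a w with allB (R (2 + a)) w in chain
  ... | false rewrite ∧-zeroʳ (g ((2 + a) ∷ w)) = refl
  ... | true  rewrite chain-from-2 R refines ℓ c a w chain | ∧-zeroʳ (g ((2 + a) ∷ w) ∧ Chain R w) = refl
  from-2-vanishes : ∑[ a ∈ upTo L ] ∑[ w ∈ words N (2 + L) ]
      𝟙 ((g ((2 + a) ∷ w) ∧ Chain R ((2 + a) ∷ w)) ∧ hasContent (suc ℓ ∷ c) ((2 + a) ∷ w)) ≡ 0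
  from-2-vanishes = trans (∑-cong (upTo L) (λ a → trans (∑-cong (words N (2 + L)) (vanishes a)) (∑-zero (words N (2 + L)))))
                          (∑-zero (upTo L))

-- Row chains: 1' and 1 may both start the chain, and then no further 1' occurs.
rowChains-suc : ∀ N ℓ c → chains rowLE (suc N) (suc ℓ) c ≡
  guardedChains avoids1′ rowLE N ℓ c + (guardedChains avoids1′ rowLE N ℓ c + 0)
rowChains-suc = guardedChains-suc (λ _ → true) rowLE rowLE-≤

-- A row chain without 1' and with value 1 present starts with 1.
rowChains-avoids1′-suc : ∀ N ℓ c → guardedChains avoids1′ rowLE (suc N) (suc ℓ) c ≡ guardedChains avoids1′ rowLE N ℓ c
rowChains-avoids1′-suc N ℓ c = begin
  guardedChains avoids1′ rowLE (suc N) (suc ℓ) c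
    ≡⟨ guardedChains-suc avoids1′ rowLE rowLE-≤ N ℓ c ⟩
  (∑[ w ∈ words N _ ] 0) + (guardedChains′ + 0)
    ≡⟨ cong₂ _+_ (∑-zero (words N _)) (+-identityʳ _) ⟩
  guardedChains′
    ≡⟨ ∑-cong (words N _) (λ w → cong (λ b → 𝟙 (b ∧ hasContent (ℓ ∷ c) w)) (idem (avoids1′ w) (Chain rowLE w))) ⟩
  guardedChains avoids1′ rowLE N ℓ c ∎
  where
  open ≡-Reasoning
  guardedChains′ = ∑[ w ∈ words N (2 + 2 * length c) ]
    𝟙 ((avoids1′ w ∧ (avoids1′ w ∧ Chain rowLE w)) ∧ hasContent (ℓ ∷ c) w)
  idem : ∀ p q → p ∧ (p ∧ q) ≡ p ∧ q
  idem true  q = refl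
  idem false q = refl

rowChains-avoids1′-0 : ∀ N c → guardedChains avoids1′ rowLE N 0 c ≡ chains rowLE N 0 c
rowChains-avoids1′-0 N c = ∑-cong (words N _) no1′
  where
  no1′ : ∀ w → 𝟙 ((avoids1′ w ∧ Chain rowLE w) ∧ hasContent (0 ∷ c) w) ≡ 𝟙 (Chain rowLE w ∧ hasContent (0 ∷ c) w)
  no1′ w with hasContent (0 ∷ c) w in h
  ... | true  rewrite avoids1⇒avoids1′ w (hasContent-0⇒avoids1 c w h) = refl
  ... | false rewrite ∧-zeroʳ (avoids1′ w ∧ Chain rowLE w) | ∧-zeroʳ (Chain rowLE w) = refl

-- Column chains: after a leading 1' anything may follow; after a leading 1 only values ≥ 2.
colChains-suc : ∀ N ℓ c → chains colLE (suc N) (suc ℓ) c ≡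
  chains colLE N ℓ c + (guardedChains avoids1 colLE N ℓ c + 0)
colChains-suc N ℓ c = trans (guardedChains-suc (λ _ → true) colLE colLE-≤ N ℓ c)
  (cong (_+ (guardedChains avoids1 colLE N ℓ c + 0))
    (∑-cong (words N _) (λ w → cong (λ b → 𝟙 ((b ∧ Chain colLE w) ∧ hasContent (ℓ ∷ c) w)) (anything-after-1′ w))))
  where
  anything-after-1′ : ∀ w → allB (colLE 0) w ≡ true
  anything-after-1′ []      = refl
  anything-after-1′ (_ ∷ w) = anything-after-1′ w

colChains-avoids1 : ∀ N ℓ c → guardedChains avoids1 colLE N ℓ c ≡ 𝟙 (ℓ ≡ᵇ 0) * colCount N c
colChains-avoids1 N ℓ c = begin
  guardedChains avoids1 colLE N ℓ c
    ≡⟨ ∑-cong (words N _) (λ w → trans (cong 𝟙 (∧-assoc (avoids1 w) _ _)) (𝟙-∧ (avoids1 w) _)) ⟩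
  ∑[ w ∈ words N (2 + 2 * length c) ] 𝟙 (avoids1 w) * 𝟙 (Chain colLE w ∧ hasContent (ℓ ∷ c) w)
    ≡⟨ ∑-avoids1 N (2 * length c) (λ w → 𝟙 (Chain colLE w ∧ hasContent (ℓ ∷ c) w)) ⟩
  ∑[ w ∈ words N (2 * length c) ] 𝟙 (Chain colLE (raise w) ∧ hasContent (ℓ ∷ c) (raise w))
    ≡⟨ ∑-cong (words N _) raised ⟩
  ∑[ w ∈ words N (2 * length c) ] 𝟙 (ℓ ≡ᵇ 0) * 𝟙 (Chain colLE w ∧ hasContent c w)
    ≡⟨ ∑-*ˡ (words N _) (𝟙 (ℓ ≡ᵇ 0)) _ ⟩
  𝟙 (ℓ ≡ᵇ 0) * colCount N c ∎
  where
  open ≡-Reasoning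
  raised : ∀ w → 𝟙 (Chain colLE (raise w) ∧ hasContent (ℓ ∷ c) (raise w))
               ≡ 𝟙 (ℓ ≡ᵇ 0) * 𝟙 (Chain colLE w ∧ hasContent c w)
  raised w rewrite Chain-raise colLE colLE-raise w | hasContent-raise ℓ c w with ℓ ≡ᵇ 0
  ... | true  = sym (+-identityʳ _)
  ... | false = ∧-zeroʳ-𝟙 (Chain colLE w)
    where
    ∧-zeroʳ-𝟙 : ∀ b → 𝟙 (b ∧ false) ≡ 0
    ∧-zeroʳ-𝟙 b rewrite ∧-zeroʳ b = refl

-- When the value 1 occurs at least twice, a leading 1 (or 1') can simply be dropped.
rowChains-shift : ∀ N ℓ c → chains rowLE (suc N) (suc (suc ℓ)) c ≡ chains rowLE N (suc ℓ) c
rowChains-shift N ℓ c = trans (rowChains-suc N (suc ℓ) c) (twice N)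
  where
  Z = λ N → guardedChains avoids1′ rowLE N (suc ℓ) c
  twice : ∀ N → Z N + (Z N + 0) ≡ chains rowLE N (suc ℓ) c
  twice zero     rewrite guardedChains-[] avoids1′ rowLE ℓ c | guardedChains-[] (λ _ → true) rowLE ℓ c = refl
  twice (suc N′) rewrite rowChains-avoids1′-suc N′ ℓ c = sym (rowChains-suc N′ ℓ c)

colChains-shift : ∀ N ℓ c → chains colLE (suc N) (suc (suc ℓ)) c ≡ chains colLE N (suc ℓ) c
colChains-shift N ℓ c = trans (colChains-suc N (suc ℓ) c)
  (trans (cong (λ y → chains colLE N (suc ℓ) c + (y + 0)) (colChains-avoids1 N (suc ℓ) c)) (+-identityʳ _))

-- Row and column tableaux of the same length and content are equinumerous
-- (both number 2^{#{i : c_i > 0}} when the length is |c|).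
rowCount≡colCount : ∀ N c → rowCount N c ≡ colCount N c
rowCount≡colCount zero    [] = refl
rowCount≡colCount (suc N) [] = refl
rowCount≡colCount N (ℓ ∷ c) = begin
  rowCount N (ℓ ∷ c)    ≡⟨ count-chains rowLE N ℓ c ⟩
  chains rowLE N ℓ c    ≡⟨ by-content N ℓ ⟩
  chains colLE N ℓ c    ≡⟨ count-chains colLE N ℓ c ⟨
  colCount N (ℓ ∷ c) ∎
  where
  open ≡-Reasoning
  tail-row : ∀ N → chains rowLE N 0 c ≡ colCount N c
  tail-row N = trans (chains-0 rowLE rowLE-raise N c) (rowCount≡colCount N c)
  by-content : ∀ N ℓ → chains rowLE N ℓ c ≡ chains colLE N ℓ c
  by-content N       zero = trans (tail-row N) (sym (chains-0 colLE colLE-raise N c))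
  by-content zero    (suc ℓ) =
    trans (guardedChains-[] (λ _ → true) rowLE ℓ c) (sym (guardedChains-[] (λ _ → true) colLE ℓ c))
  by-content (suc N) (suc zero) = begin
    chains rowLE (suc N) 1 c
      ≡⟨ rowChains-suc N 0 c ⟩
    Z + (Z + 0)
      ≡⟨ cong (λ z → z + (z + 0)) (trans (rowChains-avoids1′-0 N c) (tail-row N)) ⟩
    colCount N c + (colCount N c + 0)
      ≡⟨ cong₂ (λ x y → x + (y + 0)) (chains-0 colLE colLE-raise N c)
                                      (trans (colChains-avoids1 N 0 c) (+-identityʳ _)) ⟨
    chains colLE N 0 c + (guardedChains avoids1 colLE N 0 c + 0)
      ≡⟨ colChains-suc N 0 c ⟨
    chains colLE (suc N) 1 c ∎
    where Z = guardedChains avoids1′ rowLE N 0 c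
  by-content (suc N) (suc (suc ℓ)) =
    trans (rowChains-shift N ℓ c) (trans (by-content N (suc ℓ)) (sym (colChains-shift N ℓ c)))

q-rowCount : ∀ m c → q m c ≡ ℤ.+ rowCount m c
q-rowCount zero    c rewrite hasContent-[] c with allZero c
... | true  = refl
... | false = refl
q-rowCount (suc m) c = cong ℤ.+_ (countTableaux-row (suc m) c)

productCount : ℕ → ℕ → List ℕ → ℕ
productCount a b c = ∑[ x ∈ below c ] rowCount a x * rowCount b (c -ᴸ x)

sumℤ-+ : ∀ (xs : List (List ℕ)) (f : List ℕ → ℕ) → sumℤ (map (λ x → ℤ.+ f x) xs) ≡ ℤ.+ ∑ xs f
sumℤ-+ []       f = refl
sumℤ-+ (x ∷ xs) f = cong (λ z → ℤ.+ f x ℤ.+ z) (sumℤ-+ xs f)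

q*q : ∀ a b c → (q a *ₛ q b) c ≡ ℤ.+ productCount a b c
q*q a b c = trans
  (cong sumℤ (map-cong (λ x → trans (cong₂ ℤ._*_ (q-rowCount a x) (q-rowCount b (c -ᴸ x)))
                                    (sym (ℤ.pos-* (rowCount a x) (rowCount b (c -ᴸ x))))) (below c)))
  (sumℤ-+ (below c) (λ x → rowCount a x * rowCount b (c -ᴸ x)))

productCount-rows : ∀ a b c → productCount a b c ≡
  ∑[ u ∈ words a (2 * length c) ] ∑[ v ∈ words b (2 * length c) ]
    𝟙 (Chain rowLE u) * 𝟙 (Chain rowLE v) * 𝟙 (hasContent c (u ++ v))
productCount-rows a b c = count-convolution c a b (Chain rowLE) (Chain rowLE)

productCount-row-col : ∀ a b c → productCount a b c ≡
  ∑[ u ∈ words a (2 * length c) ] ∑[ v ∈ words b (2 * length c) ]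
    𝟙 (Chain rowLE u) * 𝟙 (Chain colLE v) * 𝟙 (hasContent c (u ++ v))
productCount-row-col a b c = trans
  (∑-cong (below c) (λ x → cong (rowCount a x *_) (rowCount≡colCount b (c -ᴸ x))))
  (count-convolution c a b (Chain rowLE) (Chain colLE))

productCount-comm : ∀ a b c → productCount a b c ≡ productCount b a c
productCount-comm a b c = begin
  productCount a b c
    ≡⟨ productCount-rows a b c ⟩
  ∑[ u ∈ words a L ] ∑[ v ∈ words b L ] 𝟙 (Chain rowLE u) * 𝟙 (Chain rowLE v) * 𝟙 (hasContent c (u ++ v))
    ≡⟨ ∑-swap (words a L) (words b L) _ ⟩
  ∑[ v ∈ words b L ] ∑[ u ∈ words a L ] 𝟙 (Chain rowLE u) * 𝟙 (Chain rowLE v) * 𝟙 (hasContent c (u ++ v))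
    ≡⟨ ∑-cong (words b L) (λ v → ∑-cong (words a L) (λ u →
         cong₂ _*_ (*-comm (𝟙 (Chain rowLE u)) _) (cong 𝟙 (hasContent-comm c u v)))) ⟩
  ∑[ v ∈ words b L ] ∑[ u ∈ words a L ] 𝟙 (Chain rowLE v) * 𝟙 (Chain rowLE u) * 𝟙 (hasContent c (v ++ u))
    ≡⟨ productCount-rows b a c ⟨
  productCount b a c ∎
  where
  open ≡-Reasoning
  L = 2 * length c

productCount-0 : ∀ a c → productCount a 0 c ≡ rowCount a c
productCount-0 a c = trans (productCount-rows a 0 c) (∑-cong (words a _) (λ u → begin
  𝟙 (Chain rowLE u) * 1 * 𝟙 (hasContent c (u ++ [])) + 0   ≡⟨ +-identityʳ _ ⟩
  𝟙 (Chain rowLE u) * 1 * 𝟙 (hasContent c (u ++ []))       ≡⟨ cong₂ _*_ (*-identityʳ (𝟙 (Chain rowLE u))) (cong (𝟙 ∘ hasContent c) (++-identityʳ u)) ⟩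
  𝟙 (Chain rowLE u) * 𝟙 (hasContent c u)                   ≡⟨ 𝟙-∧ (Chain rowLE u) (hasContent c u) ⟨
  𝟙 (Chain rowLE u ∧ hasContent c u) ∎))
  where open ≡-Reasoning

hookCount-row : ∀ m′ c → hookCount 0 m′ c ≡ rowCount (suc m′) c
hookCount-row m′ c = trans (sym (countTableaux-hook 0 m′ c)) (countTableaux-row (suc m′) c)

hookCount-col : ∀ i c → hookCount i 0 c ≡ colCount (suc i) c
hookCount-col i c = trans
  (∑-cong (words i L) (λ t → trans (+-identityʳ _) (∑-cong (upTo L) (λ x →
     cong (λ b → 𝟙 (b ∧ hasContent c (t ++ x ∷ []))) (∧-identityʳ (Chain colLE (t ++ x ∷ [])))))))
  (sym (∑-words-∷ʳ i L (λ w → 𝟙 (Chain colLE w ∧ hasContent c w))))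
  where L = 2 * length c

𝟙-split : ∀ C R H k → 𝟙 (((C ∧ not k) ∧ R) ∧ H) + 𝟙 ((C ∧ (R ∧ k)) ∧ H) ≡ 𝟙 ((C ∧ R) ∧ H)
𝟙-split false R H k     = refl
𝟙-split true  R H true  rewrite ∧-identityʳ R = refl
𝟙-split true  R H false rewrite ∧-zeroʳ R = +-identityʳ _

-- For a row word r x and a column word t z exactly one of
-- "x below z" and "z right of x" is allowed (colLE-dual), so the pair is a tableau of the
-- hook with column t z over the row r x, or of the hook with column t over the row r x z.
corner : ∀ c t z r x →
  𝟙 ((Chain colLE ((t ++ z ∷ []) ++ x ∷ []) ∧ Chain rowLE (r ++ x ∷ [])) ∧ hasContent c ((t ++ z ∷ []) ++ r ++ x ∷ [])) +
  𝟙 ((Chain colLE (t ++ z ∷ []) ∧ Chain rowLE ((r ++ x ∷ []) ++ z ∷ [])) ∧ hasContent c (t ++ (r ++ x ∷ []) ++ z ∷ []))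
  ≡ 𝟙 (Chain rowLE (r ++ x ∷ [])) * 𝟙 (Chain colLE (t ++ z ∷ [])) * 𝟙 (hasContent c ((r ++ x ∷ []) ++ t ++ z ∷ []))
corner c t z r x = begin
  𝟙 ((Chain colLE ((t ++ z ∷ []) ++ x ∷ []) ∧ ROW) ∧ H) + 𝟙 ((COL ∧ Chain rowLE ((r ++ x ∷ []) ++ z ∷ [])) ∧ H′)
    ≡⟨ cong₂ _+_ (cong (λ b → 𝟙 ((b ∧ ROW) ∧ H)) (trans (Chain-∷ʳ-trans colLE colLE-trans t z x)
                                                         (cong (COL ∧_) (colLE-dual z x))))
                 (cong₂ (λ b h → 𝟙 ((COL ∧ b) ∧ h)) (Chain-∷ʳ-trans rowLE rowLE-trans r x z) H′≡H) ⟩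
  𝟙 (((COL ∧ not (rowLE x z)) ∧ ROW) ∧ H) + 𝟙 ((COL ∧ (ROW ∧ rowLE x z)) ∧ H)
    ≡⟨ 𝟙-split COL ROW H (rowLE x z) ⟩
  𝟙 ((COL ∧ ROW) ∧ H)
    ≡⟨ trans (𝟙-∧ (COL ∧ ROW) H) (cong (_* 𝟙 H) (𝟙-∧ COL ROW)) ⟩
  𝟙 COL * 𝟙 ROW * 𝟙 H
    ≡⟨ cong₂ _*_ (*-comm (𝟙 COL) (𝟙 ROW)) (cong 𝟙 (hasContent-comm c (t ++ z ∷ []) (r ++ x ∷ []))) ⟩
  𝟙 ROW * 𝟙 COL * 𝟙 (hasContent c ((r ++ x ∷ []) ++ t ++ z ∷ [])) ∎
  where
  open ≡-Reasoning
  COL = Chain colLE (t ++ z ∷ [])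
  ROW = Chain rowLE (r ++ x ∷ [])
  H = hasContent c ((t ++ z ∷ []) ++ r ++ x ∷ [])
  H′ = hasContent c (t ++ (r ++ x ∷ []) ++ z ∷ [])
  H′≡H : H′ ≡ H
  H′≡H = trans (hasContent-exchange c t (r ++ x ∷ []) (z ∷ [])) (cong (hasContent c) (sym (++-assoc t (z ∷ []) (r ++ x ∷ []))))

hook-recurrence : ∀ i m′ c → hookCount (suc i) m′ c + hookCount i (suc m′) c ≡ productCount (suc m′) (suc i) c
hook-recurrence i m′ c = begin
  hookCount (suc i) m′ c + hookCount i (suc m′) c
    ≡⟨ cong₂ _+_ (∑-words-∷ʳ i L _) (∑-cong (words i L) (λ t → corner-last t)) ⟩
  (∑[ t ∈ words i L ] ∑[ z ∈ upTo L ] ∑[ r ∈ words m′ L ] ∑[ x ∈ upTo L ] f₁ t z r x) +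
  (∑[ t ∈ words i L ] ∑[ z ∈ upTo L ] ∑[ r ∈ words m′ L ] ∑[ x ∈ upTo L ] f₂ t z r x)
    ≡⟨ ∑-merge (words i L) (λ t → ∑-merge (upTo L) (λ z → ∑-merge (words m′ L) (λ r → ∑-merge (upTo L) (λ x →
         corner c t z r x)))) ⟩
  ∑[ t ∈ words i L ] ∑[ z ∈ upTo L ] ∑[ r ∈ words m′ L ] ∑[ x ∈ upTo L ] g (r ++ x ∷ []) (t ++ z ∷ [])
    ≡⟨ ∑-swap₂ (words i L) (upTo L) (words m′ L) (upTo L) (λ t z r x → g (r ++ x ∷ []) (t ++ z ∷ [])) ⟩
  ∑[ r ∈ words m′ L ] ∑[ x ∈ upTo L ] ∑[ t ∈ words i L ] ∑[ z ∈ upTo L ] g (r ++ x ∷ []) (t ++ z ∷ [])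
    ≡⟨ ∑-cong (words m′ L) (λ r → ∑-cong (upTo L) (λ x → ∑-words-∷ʳ i L (g (r ++ x ∷ [])))) ⟨
  ∑[ r ∈ words m′ L ] ∑[ x ∈ upTo L ] ∑[ v ∈ words (suc i) L ] g (r ++ x ∷ []) v
    ≡⟨ ∑-words-∷ʳ m′ L (λ u → ∑[ v ∈ words (suc i) L ] g u v) ⟨
  ∑[ u ∈ words (suc m′) L ] ∑[ v ∈ words (suc i) L ] g u v
    ≡⟨ productCount-row-col (suc m′) (suc i) c ⟨
  productCount (suc m′) (suc i) c ∎
  where
  open ≡-Reasoning
  L = 2 * length c
  f₁ f₂ : List ℕ → ℕ → List ℕ → ℕ → ℕ
  f₁ t z r x = 𝟙 ((Chain colLE ((t ++ z ∷ []) ++ x ∷ []) ∧ Chain rowLE (r ++ x ∷ [])) ∧ hasContent c ((t ++ z ∷ []) ++ r ++ x ∷ []))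
  f₂ t z r x = 𝟙 ((Chain colLE (t ++ z ∷ []) ∧ Chain rowLE ((r ++ x ∷ []) ++ z ∷ [])) ∧ hasContent c (t ++ (r ++ x ∷ []) ++ z ∷ []))
  g : List ℕ → List ℕ → ℕ
  g u v = 𝟙 (Chain rowLE u) * 𝟙 (Chain colLE v) * 𝟙 (hasContent c (u ++ v))
  -- in hook(i, m′+1) the corner z is the last letter of the row r x z
  corner-last : ∀ t → ∑[ rx ∈ words (suc m′) L ] ∑[ z ∈ upTo L ]
      𝟙 ((Chain colLE (t ++ z ∷ []) ∧ Chain rowLE (rx ++ z ∷ [])) ∧ hasContent c (t ++ rx ++ z ∷ []))
    ≡ ∑[ z ∈ upTo L ] ∑[ r ∈ words m′ L ] ∑[ x ∈ upTo L ] f₂ t z r x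
  corner-last t = begin
    _ ≡⟨ ∑-words-∷ʳ m′ L _ ⟩
    ∑[ r ∈ words m′ L ] ∑[ x ∈ upTo L ] ∑[ z ∈ upTo L ] f₂ t z r x   ≡⟨ ∑-cong (words m′ L) (λ r → ∑-swap (upTo L) (upTo L) _) ⟩
    ∑[ r ∈ words m′ L ] ∑[ z ∈ upTo L ] ∑[ x ∈ upTo L ] f₂ t z r x   ≡⟨ ∑-swap (words m′ L) (upTo L) _ ⟩
    ∑[ z ∈ upTo L ] ∑[ r ∈ words m′ L ] ∑[ x ∈ upTo L ] f₂ t z r x   ∎

sign-suc : ∀ m → sign (suc m) ≡ ℤ.- sign m
sign-suc zero          = refl
sign-suc (suc zero)    = refl
sign-suc (suc (suc m)) = sign-suc m

sign-even : ∀ m → sign (m + m) ≡ ℤ.+ 1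
sign-even zero    = refl
sign-even (suc m) rewrite +-suc m m = sign-even m

Σₛ-sign-suc : ∀ m K (G : ℕ → Series) c →
  Σₛ K (λ i → sign (suc (m + i)) ·ₛ G i) c ≡ ℤ.- Σₛ K (λ i → sign (m + i) ·ₛ G i) c
Σₛ-sign-suc m zero    G c = refl
Σₛ-sign-suc m (suc K) G c = begin
  Σₛ K (λ i → sign (suc (m + i)) ·ₛ G i) c ℤ.+ sign (suc (m + K)) ℤ.* G K c
    ≡⟨ cong₂ ℤ._+_ (Σₛ-sign-suc m K G c) (cong (ℤ._* G K c) (sign-suc (m + K))) ⟩
  ℤ.- Σₛ K (λ i → sign (m + i) ·ₛ G i) c ℤ.+ ℤ.- sign (m + K) ℤ.* G K c
    ≡⟨ cong (λ z → ℤ.- Σₛ K (λ i → sign (m + i) ·ₛ G i) c ℤ.+ z) (ℤ.neg-distribˡ-* (sign (m + K)) (G K c)) ⟨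
  ℤ.- Σₛ K (λ i → sign (m + i) ·ₛ G i) c ℤ.+ ℤ.- (sign (m + K) ℤ.* G K c)
    ≡⟨ ℤ.neg-distrib-+ (Σₛ K (λ i → sign (m + i) ·ₛ G i) c) (sign (m + K) ℤ.* G K c) ⟨
  ℤ.- (Σₛ K (λ i → sign (m + i) ·ₛ G i) c ℤ.+ sign (m + K) ℤ.* G K c) ∎
  where open ≡-Reasoning

alternating : ℕ → (ℕ → Series) → Series
alternating k T = Σₛ k (λ i → sign ((k + i) ∸ 1) ·ₛ T i)

alternating-suc : ∀ k T c → alternating (suc k) T c ≡ ℤ.- alternating k T c ℤ.+ T k c
alternating-suc zero    T c =
  trans (ℤ.+-identityˡ _) (trans (ℤ.*-identityˡ (T 0 c)) (sym (ℤ.+-identityˡ (T 0 c))))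
alternating-suc (suc k) T c = cong₂ ℤ._+_ (Σₛ-sign-suc k (suc k) T c)
  (trans (cong (ℤ._* T (suc k) c) (sign-even (suc k))) (ℤ.*-identityˡ _))

-- Fix n = p + 1 and a content c; h j is the coefficient of x^c in 𝔯_{△_{n,j+1}}, the hook
-- (1^j, n - j), and qq i is the product q_{n-i} q_i.
module Hooks (p : ℕ) (c : List ℕ) where

  h : ℕ → ℕ
  h j = hookCount j (p ∸ j) c

  qq : ℕ → Series
  qq i = q (suc p ∸ i) *ₛ q i

  𝔯-△ : ∀ j → 𝔯 (△ (suc p) (suc j)) c ≡ ℤ.+ h j
  𝔯-△ j rewrite +-comm (p ∸ j) 1 = cong ℤ.+_ (countTableaux-hook j (p ∸ j) c)

  h-0 : h 0 ≡ productCount (suc p) 0 c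
  h-0 = trans (hookCount-row p c) (sym (productCount-0 (suc p) c))

  h-step : ∀ j → j < p → h (suc j) + h j ≡ productCount (p ∸ j) (suc j) c
  h-step j j<p rewrite +-∸-assoc 1 j<p = hook-recurrence j (p ∸ suc j) c

  h-alternating : ∀ j → j ≤ p → ℤ.+ h j ≡ alternating (suc j) qq c
  h-alternating zero _ = begin
    ℤ.+ h 0                       ≡⟨ cong ℤ.+_ h-0 ⟩
    ℤ.+ productCount (suc p) 0 c  ≡⟨ q*q (suc p) 0 c ⟨
    qq 0 c                         ≡⟨ ℤ.+-identityˡ (qq 0 c) ⟨
    ℤ.- ℤ.+ 0 ℤ.+ qq 0 c           ≡⟨ alternating-suc 0 qq c ⟨
    alternating 1 qq c             ∎
    where open ≡-Reasoning
  h-alternating (suc j) j<p = begin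
    ℤ.+ h (suc j)
      ≡⟨ ℤ-cancel (ℤ.+ h (suc j)) (ℤ.+ h j) ⟨
    ℤ.- ℤ.+ h j ℤ.+ (ℤ.+ h (suc j) ℤ.+ ℤ.+ h j)
      ≡⟨ cong (λ z → ℤ.- ℤ.+ h j ℤ.+ z) (ℤ.pos-+ (h (suc j)) (h j)) ⟨
    ℤ.- ℤ.+ h j ℤ.+ ℤ.+ (h (suc j) + h j)
      ≡⟨ cong₂ (λ a b → ℤ.- a ℤ.+ b) (h-alternating j (<⇒≤ j<p)) (trans (cong ℤ.+_ (h-step j j<p)) (sym (q*q (p ∸ j) (suc j) c))) ⟩
    ℤ.- alternating (suc j) qq c ℤ.+ qq (suc j) c
      ≡⟨ alternating-suc (suc j) qq c ⟨
    alternating (suc (suc j)) qq c ∎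
    where
    open ≡-Reasoning
    ℤ-cancel : ∀ a b → ℤ.- b ℤ.+ (a ℤ.+ b) ≡ a
    ℤ-cancel = ℤ-solve-∀

  -- Part (b): h_j = h_{p-j}, by induction on j using q_a q_b = q_b q_a.
  h-symmetric : ∀ j → j ≤ p → h j ≡ h (p ∸ j)
  h-symmetric zero    _ rewrite n∸n≡0 p = begin
    hookCount 0 p c        ≡⟨ hookCount-row p c ⟩
    rowCount (suc p) c     ≡⟨ rowCount≡colCount (suc p) c ⟩
    colCount (suc p) c     ≡⟨ hookCount-col p c ⟨
    hookCount p 0 c        ∎
    where open ≡-Reasoning
  h-symmetric (suc j) j<p = +-cancelʳ-≡ (h (suc a)) (h (suc j)) (h a) (begin
    h (suc j) + h (suc a)               ≡⟨ cong (h (suc j) +_) IH ⟨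
    h (suc j) + h j                     ≡⟨ h-step j j<p ⟩
    productCount (p ∸ j) (suc j) c      ≡⟨ cong (λ m → productCount m (suc j) c) p∸j≡1+a ⟩
    productCount (suc a) (suc j) c      ≡⟨ productCount-comm (suc a) (suc j) c ⟩
    productCount (suc j) (suc a) c      ≡⟨ cong (λ m → productCount m (suc a) c) (m∸[m∸n]≡n j<p) ⟨
    productCount (p ∸ a) (suc a) c      ≡⟨ h-step a (a<p) ⟨
    h (suc a) + h a                     ≡⟨ +-comm (h (suc a)) (h a) ⟩
    h a + h (suc a)                     ∎)
    where
    open ≡-Reasoning
    a = p ∸ suc j
    p∸j≡1+a : p ∸ j ≡ suc a
    p∸j≡1+a = +-∸-assoc 1 j<p
    IH : h j ≡ h (suc a)
    IH = trans (h-symmetric j (<⇒≤ j<p)) (cong h p∸j≡1+a)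
    a<p : a < p
    a<p = ≤-trans (≤-reflexive (sym p∸j≡1+a)) (m∸n≤m p j)

open Hooks

lemma4p4 : (n k : ℕ) → 1 ≤ k → k ≤ n →
    (𝔯 (△ n k) ≈ₛ Σₛ k (λ i → sign ((k + i) ∸ 1) ·ₛ (q (n ∸ i) *ₛ q i)))
    × (𝔯 (△ n ((n ∸ k) + 1)) ≈ₛ 𝔯 (△ n k))
lemma4p4 (suc p) (suc j) (s≤s z≤n) (s≤s j≤p) = part-a , part-b
  where
  part-a : 𝔯 (△ (suc p) (suc j)) ≈ₛ alternating (suc j) (λ i → q (suc p ∸ i) *ₛ q i)
  part-a c = trans (𝔯-△ p c j) (h-alternating p c j j≤p)
  part-b : 𝔯 (△ (suc p) ((p ∸ j) + 1)) ≈ₛ 𝔯 (△ (suc p) (suc j))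
  part-b c = begin
    𝔯 (△ (suc p) ((p ∸ j) + 1)) c   ≡⟨ cong (λ k → 𝔯 (△ (suc p) k) c) (+-comm (p ∸ j) 1) ⟩
    𝔯 (△ (suc p) (suc (p ∸ j))) c   ≡⟨ 𝔯-△ p c (p ∸ j) ⟩
    ℤ.+ h p c (p ∸ j)               ≡⟨ cong ℤ.+_ (h-symmetric p c j j≤p) ⟨
    ℤ.+ h p c j                     ≡⟨ 𝔯-△ p c j ⟨
    𝔯 (△ (suc p) (suc j)) c         ∎
    where open ≡-Reasoning
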